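{- Let $w\in S_n$ and let $r=(r^{n-1})\cdots(r^1)\in RFC(w^{ -1})$ be a highest weight factorization. Then the Edelman–Greene insertion tableau $P(r)$ is the tableau whose $i$-th row from the bottom consists of the letters of block $r^i$ in increasing order, for each $i$. Here $P(r)$ is obtained by inserting, starting from the empty tableau, the letters of $r$ read from left to right: first the letters of $r^{n-1}$ in increasing order, then those of $r^{n-2}$, and so on down to $r^1$.
   Context: Reduced factorizations with cutoff. For $v\in S_n$, a reduced word is $a_1\cdots a_p\in[n-1]^p$ with $v=s_{a_1}\cdots s_{a_p}$ and $p=\ell(v)$, where $s_k=(k,k+1)$. $RFC(v)$ is the set of reduced words for $v$ divided into $n-1$ consecutive, possibly empty, blocks $r=(r^{n-1})\cdots(r^1)$, numbered right to left, such that letters strictly increase within each block and the leftmost letter of each nonempty $r^i$ is at least $i$. Pairing on block $i$. The letters of $r^i$ are considered from largest to smallest. A letter $a$ is paired with the smallest not-yet-paired letter $b$ of $r^{i+1}$ with $a<b$, if one exists; otherwise $a$ is unpaired. Letters of $r^{i+1}$ never paired are unpaired. Raising operator $e_i$. If all letters of $r^{i+1}$ are paired, set $e_i(r)=0$. Otherwise let $v$ be the largest unpaired letter of $r^{i+1}$ and $s=\min\{z\ge v: z+1\notin r^{i+1}\}$. Let $e_i(r)$ be obtained by removing $v$ from $r^{i+1}$ and inserting $s$ into $r^i$. If this result is not in $RFC$, set $e_i(r)=0$. $r$ is highest weight if $e_i(r)=0$ for all $1\le i<n$. Edelman–Greene insertion. Rows of a tableau are numbered from the bottom. To insert a letter $x$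 into row $P_1$, and recursively into higher rows: if $x\ge z$ for every entry $z$ of the current row (or the row is empty), append $x$ at the end of that row and stop. Otherwise let $y$ be the smallest entry of the row with $y>x$. If $y=x+1$ and $x$ already lies in the row, leave the row unchanged; otherwise replace $y$ by $x$ in the row. In either case, insert $y$ into the next row up by the same rule. The insertion tableau of a word is obtained by inserting its letters one by one into the empty tableau. -}

module Defs where

open import Data.Nat using (ℕ; zero; suc; _+_; _∸_; _≤_; _<_; _<ᵇ_; _≡ᵇ_)
open import Data.Nat.Properties using (_≟_)
open import Data.Bool using (Bool; true; false; if_then_else_; _∧_; _∨_)
open import Data.List using (List; []; _∷_; _++_; length; reverse; concat; filter; cartesianProduct)
open import Data.List.Relation.Unary.All using (All)
open import Data.List.Relation.Unary.Linked using (Linked)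
open import Data.Maybe using (Maybe; just; nothing)
open import Data.Product using (_×_; _,_)
open import Data.Fin using (Fin; toℕ)
import Data.Fin as F
open import Data.Fin.Permutation using (Permutation′; _⟨$⟩ʳ_; flip)
open import Data.List using (allFin)
open import Relation.Binary.PropositionalEquality using (_≡_)
open import Relation.Nullary using (¬_)

-- Permutations and reduced words
-- Values are 1-indexed: the permutation v ∈ S_n acts on {1,…,n};
-- an element of S_n is a  Permutation′ n  (bijection Fin n ↔ Fin n),
-- where Fin value i stands for the number i+1.

sw : ℕ → ℕ → ℕ
sw k x = if x ≡ᵇ k then suc k else (if x ≡ᵇ suc k then k else x)

wordAct : List ℕ → ℕ → ℕ
wordAct []      x = x
wordAct (a ∷ as) x = sw a (wordAct as x)

Represents : {n : ℕ} → List ℕ → Permutation′ n → Set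
Represents {n} a v = (i : Fin n) → wordAct a (suc (toℕ i)) ≡ suc (toℕ (v ⟨$⟩ʳ i))

len : {n : ℕ} → Permutation′ n → ℕ
len {n} v = length (filter (λ p → dinv p) (cartesianProduct (allFin n) (allFin n)))
  where
  open import Relation.Nullary.Decidable using (_×-dec_)
  dinv : (p : Fin n × Fin n) → _
  dinv (i , j) = (i F.<? j) ×-dec ((v ⟨$⟩ʳ j) F.<? (v ⟨$⟩ʳ i))

ReducedWord : {n : ℕ} → List ℕ → Permutation′ n → Set
ReducedWord {n} a v =
  All (λ x → 1 ≤ x × x ≤ n ∸ 1) a × Represents a v × length a ≡ len v

-- Factorizations.
-- A factorization r = (r^{n-1})⋯(r^1) is stored as the list
-- [ r^1 , r^2 , … , r^{n-1} ]  (block r^i at position i-1).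

Fact : Set
Fact = List (List ℕ)

-- block r^i (i ≥ 1); [] outside the range
blk : Fact → ℕ → List ℕ
blk []       _             = []
blk (b ∷ bs) zero          = []
blk (b ∷ bs) (suc zero)    = b
blk (b ∷ bs) (suc (suc i)) = blk bs (suc i)

setBlk : ℕ → List ℕ → Fact → Fact
setBlk _             _ []       = []
setBlk zero          _ bs       = bs
setBlk (suc zero)    c (b ∷ bs) = c ∷ bs
setBlk (suc (suc i)) c (b ∷ bs) = b ∷ setBlk (suc i) c bs

word : Fact → List ℕ
word r = concat (reverse r)

CutoffOK : ℕ → List ℕ → Set
CutoffOK i []      = Data.Unit.⊤ where import Data.Unit
CutoffOK i (x ∷ _) = i ≤ x

RFC : {n : ℕ} → Permutation′ n → Fact → Set
RFC {n} v r =
  length r ≡ n ∸ 1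
  × ReducedWord (word r) v
  × ((i : ℕ) → 1 ≤ i → i ≤ n ∸ 1 → Linked _<_ (blk r i) × CutoffOK i (blk r i))

removeFirstGt : ℕ → List ℕ → List ℕ
removeFirstGt a []       = []
removeFirstGt a (b ∷ bs) = if a <ᵇ b then bs else b ∷ removeFirstGt a bs

-- unpaired letters of B = r^{i+1}, given the letters of A = r^i
-- listed from largest to smallest
unpairedFrom : List ℕ → List ℕ → List ℕ
unpairedFrom []       bs = bs
unpairedFrom (a ∷ as) bs = unpairedFrom as (removeFirstGt a bs)

unpaired : ℕ → Fact → List ℕ
unpaired i r = unpairedFrom (reverse (blk r i)) (blk r (suc i))

memb : ℕ → List ℕ → Bool
memb x []       = false
memb x (y ∷ ys) = (x ≡ᵇ y) ∨ memb x ys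

remove : ℕ → List ℕ → List ℕ
remove x []       = []
remove x (y ∷ ys) = if x ≡ᵇ y then ys else y ∷ remove x ys

insertSorted : ℕ → List ℕ → List ℕ
insertSorted x []       = x ∷ []
insertSorted x (y ∷ ys) = if y <ᵇ x then y ∷ insertSorted x ys else x ∷ y ∷ ys

lastOr : ℕ → List ℕ → ℕ
lastOr d []       = d
lastOr d (x ∷ xs) = lastOr x xs

-- s = min { z ≥ v : z+1 ∉ B }  (fuel: |B|+1 steps always suffice)
findS : ℕ → List ℕ → ℕ → ℕ
findS zero     B z = z
findS (suc f)  B z = if memb (suc z) B then findS f B (suc z) else z

-- candidate for e_i(r) before the RFC test; nothing = all letters of r^{i+1} paired
raiseCand : ℕ → Fact → Maybe Fact
raiseCand i r with unpaired i r
... | []     = nothing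
... | u ∷ us =
  let B = blk r (suc i)
      v = lastOr u us
      s = findS (suc (length B)) B v
  in just (setBlk i (insertSorted s (blk r i)) (setBlk (suc i) (remove v B) r))

-- e_i(r) = 0 : either all paired, or the candidate is not in RFC(v)
RaiseZero : {n : ℕ} → Permutation′ n → ℕ → Fact → Set
RaiseZero v i r = (r' : Fact) → raiseCand i r ≡ just r' → ¬ RFC v r'

HighestWeight : {n : ℕ} → Permutation′ n → Fact → Set
HighestWeight {n} v r = (i : ℕ) → 1 ≤ i → i < n → RaiseZero v i r

-- Edelman–Greene insertion.  A tableau is a list of rows, bottom row first,
-- each row listed left to right.

Tableau : Set
Tableau = List (List ℕ)

allLe : List ℕ → ℕ → Bool
allLe []       x = true
allLe (z ∷ zs) x = (z <ᵇ suc x) ∧ allLe zs x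

firstGt : ℕ → List ℕ → ℕ → ℕ
firstGt x []       d = d
firstGt x (y ∷ ys) d = if x <ᵇ y then y else firstGt x ys d

replaceFirst : ℕ → ℕ → List ℕ → List ℕ
replaceFirst y x []       = []
replaceFirst y x (z ∷ zs) = if z ≡ᵇ y then x ∷ zs else z ∷ replaceFirst y x zs

insRow : ℕ → List ℕ → List ℕ × Maybe ℕ
insRow x row =
  if allLe row x then (row ++ (x ∷ []) , nothing)
  else (let y = firstGt x row x in
        if (y ≡ᵇ suc x) ∧ memb x row then (row , just y)
        else (replaceFirst y x row , just y))

egInsert : ℕ → Tableau → Tableau
egInsert x []           = (x ∷ []) ∷ []
egInsert x (row ∷ rows) with insRow x row
... | (row' , nothing) = row' ∷ rows
... | (row' , just y)  = row' ∷ egInsert y rows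

insertWord : List ℕ → Tableau → Tableau
insertWord []       T = T
insertWord (x ∷ xs) T = insertWord xs (egInsert x T)

P : List ℕ → Tableau
P a = insertWord a []

-- i-th row from the bottom (i ≥ 1); [] if absent
row : Tableau → ℕ → List ℕ
row = blk

-- If every letter of r^{i+1} is paired with a smaller letter of r^i, then r^{i+1} can sit on
-- top of r^i as the next row of a tableau. Suppose some letter is unpaired in a
-- highest weight r; let c be the largest one and c, c+1, …, c+k = s the maximal run of r^{i+1}
-- starting at c. Counting the pairing shows that c, …, s-1 lie in r^i while c-1 does not. If s
-- also lies in r^i, commutation and braid relations rewrite r^{i+1} r^i into a word with two
-- fewer letters, contradicting reducedness; otherwise the same relations show that e_i(r), which
-- moves c out of r^{i+1} and s into r^i, is again in RFC, contradicting e_i(r) = 0. Finally, when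
-- the blocks are column-strict rows, inserting the top row and then each lower row makes every
-- letter of a row bump the letter above it, so the insertion tableau just rebuilds the rows.

module Submission where

open import Defs
open import Data.Nat
open import Data.Nat.Properties
open import Data.Nat.Tactic.RingSolver using (solve-∀)
open import Data.Bool using (true; false)
open import Data.Bool.Properties using (∧-zeroʳ)
open import Data.Fin using (Fin; toℕ)
import Data.Fin as F
open import Data.Fin.Properties using (toℕ-injective)
open import Data.Fin.Permutation using (Permutation′; flip)
open import Data.List using (List; []; _∷_; _++_; _∷ʳ_; length; reverse; concat; filter; cartesianProduct; allFin)
open import Data.List.Properties
  using (++-assoc; ++-identityʳ; length-++; reverse-++; concat-++; unfold-reverse;
         filter-++; filter-none; filter-all; filter-accept; filter-reject; filter-≐; length-filter)
open import Data.List.Relation.Unary.All as All using (All; []; _∷_)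
import Data.List.Relation.Unary.All.Properties as All
open import Data.List.Relation.Unary.AllPairs using (AllPairs; []; _∷_)
import Data.List.Relation.Unary.AllPairs.Properties as AllPairs
open import Data.List.Relation.Unary.Linked as Linked using (Linked; []; [-]; _∷_)
open import Data.List.Relation.Unary.Linked.Properties using (Linked⇒AllPairs; AllPairs⇒Linked)
open import Data.List.Relation.Unary.Any using (here; there)
open import Data.List.Relation.Unary.Any.Properties using (reverse⁺)
open import Data.List.Relation.Unary.Unique.Propositional using (Unique)
open import Data.List.Relation.Unary.Unique.Propositional.Properties using (cartesianProduct⁺; allFin⁺)
open import Data.List.Membership.Propositional using (_∈_; _∉_)
open import Data.List.Membership.Propositional.Properties using (∈-++⁺ˡ; ∈-++⁺ʳ; ∈-++⁻; ∈-∃++)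
open import Data.List.Membership.DecPropositional _≟_ using (_∈?_)
open import Data.List.Relation.Binary.Permutation.Propositional.Properties using (↭-length; filter-↭; ↭-reverse)
open import Data.List.Relation.Binary.Prefix.Heterogeneous using (Prefix; []; _∷_)
open import Data.Maybe using (just; nothing)
open import Data.Product using (_×_; _,_; proj₁; proj₂; ∃; ∃₂)
open import Data.Sum using (_⊎_; inj₁; inj₂)
import Data.Sum as Sum
open import Function using (_∘_)
open import Level using (0ℓ)
open import Relation.Binary.Bundles using (Setoid)
open import Relation.Binary.Structures using (IsEquivalence)
import Relation.Binary.Reasoning.Setoid
open import Relation.Nullary using (¬_; yes; no; does; contradiction)
open import Relation.Nullary.Decidable using (_×-dec_)
open import Relation.Nullary.Reflects using (Reflects; ofʸ; ofⁿ)
open import Relation.Unary using (Pred; Decidable)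
open import Relation.Binary.PropositionalEquality

≡ᵇ-true : ∀ {m n} → m ≡ n → (m ≡ᵇ n) ≡ true
≡ᵇ-true {m} {n} m≡n with m ≡ᵇ n | ≡⇒≡ᵇ m n m≡n
... | true | _ = refl

≡ᵇ-false : ∀ {m n} → m ≢ n → (m ≡ᵇ n) ≡ false
≡ᵇ-false {m} {n} m≢n with m ≡ᵇ n | ≡ᵇ⇒≡ m n
... | false | _      = refl
... | true  | m≡ᵇn⇒ = contradiction (m≡ᵇn⇒ _) m≢n

<ᵇ-true : ∀ {m n} → m < n → (m <ᵇ n) ≡ true
<ᵇ-true {m} {n} m<n with m <ᵇ n | <⇒<ᵇ m<n
... | true | _ = refl

<ᵇ-false : ∀ {m n} → m ≮ n → (m <ᵇ n) ≡ false
<ᵇ-false {m} {n} m≮n with m <ᵇ n | <ᵇ⇒< m n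
... | false | _      = refl
... | true  | m<ᵇn⇒ = contradiction (m<ᵇn⇒ _) m≮n

-- Increasing lists and runs of consecutive letters

Increasing : List ℕ → Set
Increasing = AllPairs _<_

module _ {A : Set} {R : A → A → Set} where

  AllPairs-++⁻ˡ : ∀ xs {ys} → AllPairs R (xs ++ ys) → AllPairs R xs
  AllPairs-++⁻ˡ []       _          = []
  AllPairs-++⁻ˡ (x ∷ xs) (rx ∷ rxs) = All.++⁻ˡ xs rx ∷ AllPairs-++⁻ˡ xs rxs

  AllPairs-++⁻ʳ : ∀ xs {ys} → AllPairs R (xs ++ ys) → AllPairs R ys
  AllPairs-++⁻ʳ []       rys       = rys
  AllPairs-++⁻ʳ (x ∷ xs) (_ ∷ rxs) = AllPairs-++⁻ʳ xs rxs

  AllPairs-delete : ∀ xs {y ys} → AllPairs R (xs ++ y ∷ ys) → AllPairs R (xs ++ ys)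
  AllPairs-delete []       (_ ∷ rys)  = rys
  AllPairs-delete (x ∷ xs) (rx ∷ rxs) =
    All.++⁺ (All.++⁻ˡ xs rx) (All.tail (All.++⁻ʳ xs rx)) ∷ AllPairs-delete xs rxs

  AllPairs-middle : ∀ xs {y ys} → AllPairs R (xs ++ y ∷ ys) → All (R y) ys
  AllPairs-middle xs rxs with AllPairs-++⁻ʳ xs rxs
  ... | ry ∷ _ = ry

  AllPairs-++-cross : ∀ xs {ys} → AllPairs R (xs ++ ys) → All (λ x → All (R x) ys) xs
  AllPairs-++-cross []       _          = []
  AllPairs-++-cross (x ∷ xs) (rx ∷ rxs) = All.++⁻ʳ xs rx ∷ AllPairs-++-cross xs rxs

increasing-≥ : ∀ {p x xs} → Increasing (x ∷ xs) → p ≤ x → All (p ≤_) (x ∷ xs)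
increasing-≥ (x<xs ∷ _) p≤x = p≤x ∷ All.map (λ x<y → ≤-trans p≤x (<⇒≤ x<y)) x<xs

increasing-before : ∀ D {a as} → Increasing (D ++ a ∷ as) → All (_< a) D
increasing-before D inc = All.map All.head (AllPairs-++-cross D inc)

++-assoc₃ : ∀ (p q r s : List ℕ) → (p ++ q ++ r) ++ s ≡ p ++ q ++ r ++ s
++-assoc₃ p q r s = trans (++-assoc p (q ++ r) s) (cong (p ++_) (++-assoc q r s))

length-++₃ : ∀ (p q s : List ℕ) → length (p ++ q ++ s) ≡ length p + (length q + length s)
length-++₃ p q s = trans (length-++ p) (cong (length p +_) (length-++ q))

length-++₆ : ∀ (p q r s t u : List ℕ) →
  length (p ++ q ++ r ++ s ++ t ++ u) ≡ length p + (length q + (length r + (length s + (length t + length u))))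
length-++₆ p q r s t u =
  trans (length-++ p) (cong (length p +_) (trans (length-++ q) (cong (length q +_)
  (trans (length-++ r) (cong (length r +_) (trans (length-++ s) (cong (length s +_) (length-++ t))))))))

consecutive : ℕ → ℕ → List ℕ
consecutive v zero    = []
consecutive v (suc k) = v ∷ consecutive (suc v) k

consecutive-∷ʳ : ∀ v k → consecutive v (suc k) ≡ consecutive v k ∷ʳ (v + k)
consecutive-∷ʳ v zero    = cong (_∷ []) (sym (+-identityʳ v))
consecutive-∷ʳ v (suc k) rewrite consecutive-∷ʳ (suc v) k | +-suc v k = refl

consecutive-≥ : ∀ v k → All (v ≤_) (consecutive v k)
consecutive-≥ v zero    = []
consecutive-≥ v (suc k) = ≤-refl ∷ All.map (≤-trans (n≤1+n v)) (consecutive-≥ (suc v) k)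

consecutive-< : ∀ v k → All (_< v + k) (consecutive v k)
consecutive-< v zero    = []
consecutive-< v (suc k) rewrite +-suc v k = s≤s (m≤m+n v k) ∷ consecutive-< (suc v) k

length-consecutive : ∀ p k → length (consecutive p k) ≡ k
length-consecutive p zero    = refl
length-consecutive p (suc k) = cong suc (length-consecutive (suc p) k)

consecutive-increasing : ∀ p k → Increasing (consecutive p k)
consecutive-increasing p zero    = []
consecutive-increasing p (suc k) = consecutive-≥ (suc p) k ∷ consecutive-increasing (suc p) k

Between : ℕ → ℕ → ℕ → Set
Between c s x = c ≤ x × x ≤ s

consecutive-between : ∀ {c s} v k → c ≤ v → v + k ≤ suc s → All (Between c s) (consecutive v k)
consecutive-between v k c≤v v+k≤1+s =
  All.zipWith (λ (v≤x , x<v+k) → ≤-trans c≤v v≤x , s≤s⁻¹ (<-≤-trans x<v+k v+k≤1+s))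
              (consecutive-≥ v k , consecutive-< v k)

split-< : ∀ p {L} → Increasing L → ∃₂ λ L₁ L₂ → L ≡ L₁ ++ L₂ × All (_< p) L₁ × All (p ≤_) L₂
split-< p {[]}     []                = [] , [] , refl , [] , []
split-< p {x ∷ xs} inc@(_ ∷ xs-inc) with x <? p
... | no x≮p  = [] , x ∷ xs , refl , [] , increasing-≥ inc (≮⇒≥ x≮p)
... | yes x<p with split-< p xs-inc
...   | L₁ , L₂ , refl , L₁<p , p≤L₂ = x ∷ L₁ , L₂ , refl , x<p ∷ L₁<p , p≤L₂

consecutive-prefix : ∀ p k {L} → Increasing L → All (p ≤_) L → (∀ j → j < k → p + j ∈ L) →
  ∃ λ L₂ → L ≡ consecutive p k ++ L₂ × All (p + k ≤_) L₂
consecutive-prefix p zero    {L}      _ p≤L _ = L , refl , subst (λ t → All (t ≤_) L) (sym (+-identityʳ p)) p≤L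
consecutive-prefix p (suc k) {[]}     _ _ ∈L  = contradiction (∈L 0 z<s) λ ()
consecutive-prefix p (suc k) {x ∷ xs} (x<xs ∷ xs-inc) (p≤x ∷ _) ∈L with ∈L 0 z<s
... | there p∈xs = contradiction (All.lookup x<xs p∈xs) (≤⇒≯ (subst (_≤ x) (sym (+-identityʳ p)) p≤x))
... | here p+0≡x with trans (sym (+-identityʳ p)) p+0≡x
...   | refl with consecutive-prefix (suc p) k xs-inc x<xs ∈xs
  where
  ∈xs : ∀ j → j < k → suc p + j ∈ xs
  ∈xs j j<k with ∈L (suc j) (s≤s j<k)
  ... | here p+1+j≡p = contradiction p+1+j≡p (>⇒≢ (≤-trans (s≤s (m≤m+n p j)) (≤-reflexive (sym (+-suc p j)))))
  ... | there ∈xs′   = subst (_∈ xs) (+-suc p j) ∈xs′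
...     | L₂ , refl , high = L₂ , refl , subst (λ t → All (t ≤_) L₂) (sym (+-suc p k)) high

∈-++-≥ : ∀ {p y} L₁ {L₂} → All (_< p) L₁ → p ≤ y → y ∈ L₁ ++ L₂ → y ∈ L₂
∈-++-≥ L₁ L₁<p p≤y y∈ with ∈-++⁻ L₁ y∈
... | inj₁ y∈L₁ = contradiction (All.lookup L₁<p y∈L₁) (≤⇒≯ p≤y)
... | inj₂ y∈L₂ = y∈L₂

consecutive-split : ∀ p k {L} → Increasing L → (∀ j → j < k → p + j ∈ L) →
  ∃₂ λ L₁ L₂ → L ≡ L₁ ++ consecutive p k ++ L₂ × All (_< p) L₁ × All (p + k ≤_) L₂
consecutive-split p k inc ∈L with split-< p inc
... | L₁ , L′ , refl , L₁<p , p≤L′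
  with consecutive-prefix p k (AllPairs-++⁻ʳ L₁ inc) p≤L′ (λ j j<k → ∈-++-≥ L₁ L₁<p (m≤m+n p j) (∈L j j<k))
...   | L₂ , refl , high = L₁ , L₂ , refl , L₁<p , high

head-or-above : ∀ {t L} → Increasing L → All (t ≤_) L → (∃ λ L′ → L ≡ t ∷ L′) ⊎ All (t <_) L
head-or-above {t} {[]}    _   _         = inj₂ []
head-or-above {t} {x ∷ L} inc (t≤x ∷ _) with x ≟ t
... | yes refl = inj₁ (L , refl)
... | no x≢t   = inj₂ (increasing-≥ inc (≤∧≢⇒< t≤x (x≢t ∘ sym)))

sw-left : ∀ a → sw a a ≡ suc a
sw-left a rewrite ≡ᵇ-true {a} refl = refl

sw-right : ∀ a → sw a (suc a) ≡ a
sw-right a rewrite ≡ᵇ-false (>⇒≢ (n<1+n a)) | ≡ᵇ-true {suc a} refl = refl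

sw-fixed : ∀ {a x} → x ≢ a → x ≢ suc a → sw a x ≡ x
sw-fixed x≢a x≢1+a rewrite ≡ᵇ-false x≢a | ≡ᵇ-false x≢1+a = refl

sw-below : ∀ {a x} → x < a → sw a x ≡ x
sw-below x<a = sw-fixed (<⇒≢ x<a) (<⇒≢ (m<n⇒m<1+n x<a))

sw-above : ∀ {a x} → suc a < x → sw a x ≡ x
sw-above 1+a<x = sw-fixed (>⇒≢ (<-trans (n<1+n _) 1+a<x)) (>⇒≢ 1+a<x)

sw-involutive : ∀ a x → sw a (sw a x) ≡ x
sw-involutive a x with x ≟ a | x ≟ suc a
... | yes refl | _        = trans (cong (sw a) (sw-left a)) (sw-right a)
... | no _     | yes refl = trans (cong (sw a) (sw-right a)) (sw-left a)
... | no x≢a   | no x≢1+a = trans (cong (sw a) (sw-fixed x≢a x≢1+a)) (sw-fixed x≢a x≢1+a)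

sw-injective : ∀ a {x y} → sw a x ≡ sw a y → x ≡ y
sw-injective a {x} {y} eq = begin
  x               ≡⟨ sw-involutive a x ⟨
  sw a (sw a x)   ≡⟨ cong (sw a) eq ⟩
  sw a (sw a y)   ≡⟨ sw-involutive a y ⟩
  y               ∎
  where open ≡-Reasoning

sw-≤ : ∀ {a x} → x ≤ suc a → sw a x ≤ suc a
sw-≤ {a} {x} x≤1+a with x ≟ a | x ≟ suc a
... | yes refl | _        = ≤-reflexive (sw-left a)
... | no _     | yes refl = ≤-trans (≤-reflexive (sw-right a)) (n≤1+n a)
... | no x≢a   | no x≢1+a = ≤-trans (≤-reflexive (sw-fixed x≢a x≢1+a)) x≤1+a

sw-≥ : ∀ {a x m} → m ≤ x → m ≤ a → m ≤ sw a x
sw-≥ {a} {x} m≤x m≤a with x ≟ a | x ≟ suc a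
... | yes refl | _        = ≤-trans (m≤n⇒m≤1+n m≤a) (≤-reflexive (sym (sw-left a)))
... | no _     | yes refl = ≤-trans m≤a (≤-reflexive (sym (sw-right a)))
... | no x≢a   | no x≢1+a = ≤-trans m≤x (≤-reflexive (sym (sw-fixed x≢a x≢1+a)))

Distant : ℕ → ℕ → Set
Distant a b = suc a < b ⊎ suc b < a

sw-comm-< : ∀ {a b} → suc a < b → ∀ x → sw a (sw b x) ≡ sw b (sw a x)
sw-comm-< {a} {b} 1+a<b x with x ≤? suc a
... | yes x≤1+a = trans (cong (sw a) (sw-below (≤-<-trans x≤1+a 1+a<b)))
                        (sym (sw-below (≤-<-trans (sw-≤ x≤1+a) 1+a<b)))
... | no x≰1+a  = trans (sw-above (sw-≥ (≰⇒> x≰1+a) 1+a<b))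
                        (cong (sw b) (sym (sw-above (≰⇒> x≰1+a))))

sw-comm : ∀ {a b} → Distant a b → ∀ x → sw a (sw b x) ≡ sw b (sw a x)
sw-comm (inj₁ 1+a<b) x = sw-comm-< 1+a<b x
sw-comm (inj₂ 1+b<a) x = sym (sw-comm-< 1+b<a x)

sw-braid : ∀ a x → sw a (sw (suc a) (sw a x)) ≡ sw (suc a) (sw a (sw (suc a) x))
sw-braid a x with x ≟ a | x ≟ suc a | x ≟ suc (suc a)
... | yes refl | _ | _ = begin
  sw a (sw (suc a) (sw a a))        ≡⟨ cong (sw a ∘ sw (suc a)) (sw-left a) ⟩
  sw a (sw (suc a) (suc a))         ≡⟨ cong (sw a) (sw-left (suc a)) ⟩
  sw a (suc (suc a))                ≡⟨ sw-above ≤-refl ⟩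
  suc (suc a)                       ≡⟨ sw-left (suc a) ⟨
  sw (suc a) (suc a)                ≡⟨ cong (sw (suc a)) (sw-left a) ⟨
  sw (suc a) (sw a a)               ≡⟨ cong (sw (suc a) ∘ sw a) (sw-below (n<1+n a)) ⟨
  sw (suc a) (sw a (sw (suc a) a))  ∎
  where open ≡-Reasoning
... | no _ | yes refl | _ = begin
  sw a (sw (suc a) (sw a (suc a)))        ≡⟨ cong (sw a ∘ sw (suc a)) (sw-right a) ⟩
  sw a (sw (suc a) a)                     ≡⟨ cong (sw a) (sw-below (n<1+n a)) ⟩
  sw a a                                  ≡⟨ sw-left a ⟩
  suc a                                   ≡⟨ sw-right (suc a) ⟨
  sw (suc a) (suc (suc a))                ≡⟨ cong (sw (suc a)) (sw-above ≤-refl) ⟨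
  sw (suc a) (sw a (suc (suc a)))         ≡⟨ cong (sw (suc a) ∘ sw a) (sw-left (suc a)) ⟨
  sw (suc a) (sw a (sw (suc a) (suc a)))  ∎
  where open ≡-Reasoning
... | no _ | no _ | yes refl = begin
  sw a (sw (suc a) (sw a (suc (suc a))))  ≡⟨ cong (sw a ∘ sw (suc a)) (sw-above ≤-refl) ⟩
  sw a (sw (suc a) (suc (suc a)))         ≡⟨ cong (sw a) (sw-right (suc a)) ⟩
  sw a (suc a)                            ≡⟨ sw-right a ⟩
  a                                       ≡⟨ sw-below (n<1+n a) ⟨
  sw (suc a) a                            ≡⟨ cong (sw (suc a)) (sw-right a) ⟨
  sw (suc a) (sw a (suc a))               ≡⟨ cong (sw (suc a) ∘ sw a) (sw-right (suc a)) ⟨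
  sw (suc a) (sw a (sw (suc a) (suc (suc a)))) ∎
  where open ≡-Reasoning
... | no x≢a | no x≢1+a | no x≢2+a
  rewrite sw-fixed x≢a x≢1+a | sw-fixed x≢1+a x≢2+a | sw-fixed x≢a x≢1+a | sw-fixed x≢1+a x≢2+a = refl

-- Words acting as the same permutation

infix 4 _≈ʷ_

record _≈ʷ_ (p q : List ℕ) : Set where
  constructor mk≈ʷ
  field act : ∀ x → wordAct p x ≡ wordAct q x
open _≈ʷ_ public

≈ʷ-isEquivalence : IsEquivalence _≈ʷ_
≈ʷ-isEquivalence = record
  { refl  = mk≈ʷ λ _ → refl
  ; sym   = λ p≈q → mk≈ʷ λ x → sym (act p≈q x)
  ; trans = λ p≈q q≈r → mk≈ʷ λ x → trans (act p≈q x) (act q≈r x)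
  }

≈ʷ-setoid : Setoid _ _
≈ʷ-setoid = record { isEquivalence = ≈ʷ-isEquivalence }

open IsEquivalence ≈ʷ-isEquivalence public
  using () renaming (refl to ≈ʷ-refl; reflexive to ≈ʷ-reflexive)

module ≈ʷ-Reasoning = Relation.Binary.Reasoning.Setoid ≈ʷ-setoid

wordAct-++ : ∀ p q x → wordAct (p ++ q) x ≡ wordAct p (wordAct q x)
wordAct-++ []      q x = refl
wordAct-++ (a ∷ p) q x = cong (sw a) (wordAct-++ p q x)

≈ʷ-++⁺ : ∀ {p p′ q q′} → p ≈ʷ p′ → q ≈ʷ q′ → p ++ q ≈ʷ p′ ++ q′
≈ʷ-++⁺ {p} {p′} {q} {q′} p≈p′ q≈q′ = mk≈ʷ λ x → begin
  wordAct (p ++ q) x       ≡⟨ wordAct-++ p q x ⟩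
  wordAct p (wordAct q x)  ≡⟨ cong (wordAct p) (act q≈q′ x) ⟩
  wordAct p (wordAct q′ x) ≡⟨ act p≈p′ (wordAct q′ x) ⟩
  wordAct p′ (wordAct q′ x) ≡⟨ wordAct-++ p′ q′ x ⟨
  wordAct (p′ ++ q′) x     ∎
  where open ≡-Reasoning

≈ʷ-++ˡ : ∀ p {q q′} → q ≈ʷ q′ → p ++ q ≈ʷ p ++ q′
≈ʷ-++ˡ p = ≈ʷ-++⁺ (≈ʷ-refl {p})

≈ʷ-++ʳ : ∀ {p p′} q → p ≈ʷ p′ → p ++ q ≈ʷ p′ ++ q
≈ʷ-++ʳ q p≈p′ = ≈ʷ-++⁺ p≈p′ (≈ʷ-refl {q})

∷-comm-distant : ∀ {a} q → All (Distant a) q → a ∷ q ≈ʷ q ∷ʳ a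
∷-comm-distant []      []         = ≈ʷ-refl
∷-comm-distant (b ∷ q) (a⋯b ∷ a⋯q) = mk≈ʷ λ x →
  trans (sw-comm a⋯b (wordAct q x)) (cong (sw b) (act (∷-comm-distant q a⋯q) x))

++-comm-distant : ∀ p q → All (λ a → All (Distant a) q) p → p ++ q ≈ʷ q ++ p
++-comm-distant []      q []           = ≈ʷ-reflexive (sym (++-identityʳ q))
++-comm-distant (a ∷ p) q (a⋯q ∷ p⋯q) = begin
  a ∷ p ++ q       ≈⟨ ≈ʷ-++ˡ (a ∷ []) (++-comm-distant p q p⋯q) ⟩
  (a ∷ q) ++ p     ≈⟨ ≈ʷ-++ʳ p (∷-comm-distant q a⋯q) ⟩
  (q ∷ʳ a) ++ p    ≡⟨ ++-assoc q (a ∷ []) p ⟩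
  q ++ a ∷ p       ∎
  where open ≈ʷ-Reasoning

move-distant : ∀ {a} p q → All (Distant a) p → p ++ a ∷ q ≈ʷ a ∷ p ++ q
move-distant {a} p q a⋯p = begin
  p ++ a ∷ q      ≡⟨ ++-assoc p (a ∷ []) q ⟨
  (p ∷ʳ a) ++ q   ≈⟨ ≈ʷ-++ʳ q (∷-comm-distant p a⋯p) ⟨
  a ∷ p ++ q      ∎
  where open ≈ʷ-Reasoning

braid : ∀ a q → a ∷ suc a ∷ a ∷ q ≈ʷ suc a ∷ a ∷ suc a ∷ q
braid a q = mk≈ʷ λ x → sw-braid a (wordAct q x)

cancel : ∀ a → a ∷ a ∷ [] ≈ʷ []
cancel a = mk≈ʷ (sw-involutive a)

consecutive-braid : ∀ v k → consecutive v (suc k) ++ consecutive v k ≈ʷ consecutive (suc v) k ++ consecutive v (suc k)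
consecutive-braid v zero    = ≈ʷ-refl
consecutive-braid v (suc k) = begin
  v ∷ suc v ∷ R ++ v ∷ S         ≈⟨ ≈ʷ-++ˡ (v ∷ suc v ∷ []) (move-distant R S v⋯R) ⟩
  v ∷ suc v ∷ v ∷ R ++ S         ≈⟨ braid v (R ++ S) ⟩
  suc v ∷ v ∷ suc v ∷ R ++ S     ≈⟨ ≈ʷ-++ˡ (suc v ∷ v ∷ []) (consecutive-braid (suc v) k) ⟩
  suc v ∷ v ∷ R ++ suc v ∷ R     ≈⟨ ≈ʷ-++ˡ (suc v ∷ []) (move-distant R (suc v ∷ R) v⋯R) ⟨
  suc v ∷ R ++ v ∷ suc v ∷ R     ∎
  where
  open ≈ʷ-Reasoning
  R = consecutive (suc (suc v)) k
  S = consecutive (suc v) k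
  v⋯R : All (Distant v) R
  v⋯R = All.map inj₁ (consecutive-≥ (suc (suc v)) k)

consecutive-square : ∀ v k → consecutive v (suc k) ++ consecutive v (suc k) ≈ʷ consecutive (suc v) k ++ consecutive v k
consecutive-square v k = begin
  R ++ R                    ≡⟨ cong (R ++_) (consecutive-∷ʳ v k) ⟩
  R ++ Q ∷ʳ c               ≡⟨ ++-assoc R Q (c ∷ []) ⟨
  (R ++ Q) ++ c ∷ []        ≈⟨ ≈ʷ-++ʳ (c ∷ []) (consecutive-braid v k) ⟩
  (R′ ++ R) ++ c ∷ []       ≡⟨ cong (λ t → (R′ ++ t) ++ c ∷ []) (consecutive-∷ʳ v k) ⟩
  (R′ ++ Q ∷ʳ c) ++ c ∷ []  ≡⟨ ++-assoc₃ R′ Q (c ∷ []) (c ∷ []) ⟩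
  R′ ++ Q ++ c ∷ c ∷ []     ≈⟨ ≈ʷ-++ˡ R′ (≈ʷ-++ˡ Q (cancel c)) ⟩
  R′ ++ Q ++ []             ≡⟨ cong (R′ ++_) (++-identityʳ Q) ⟩
  R′ ++ Q                   ∎
  where
  open ≈ʷ-Reasoning
  R = consecutive v (suc k)
  R′ = consecutive (suc v) k
  Q = consecutive v k
  c = v + k

rearrange : ∀ {c s} R B₂ A₁ Q A₂ → c ≤ s →
  All (Between c s) R → All (Between c s) Q → All (λ b → suc s < b) B₂ → All (λ a → suc a < c) A₁ →
  R ++ B₂ ++ A₁ ++ Q ++ A₂ ≈ʷ A₁ ++ R ++ Q ++ B₂ ++ A₂
rearrange {c} {s} R B₂ A₁ Q A₂ c≤s R-mid Q-mid B₂-high A₁-low = begin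
  R ++ B₂ ++ A₁ ++ Q ++ A₂      ≡⟨ cong (R ++_) (++-assoc B₂ A₁ (Q ++ A₂)) ⟨
  R ++ (B₂ ++ A₁) ++ Q ++ A₂    ≈⟨ ≈ʷ-++ˡ R (≈ʷ-++ʳ (Q ++ A₂) (++-comm-distant B₂ A₁ B₂⋯A₁)) ⟩
  R ++ (A₁ ++ B₂) ++ Q ++ A₂    ≡⟨ trans (cong (R ++_) (++-assoc A₁ B₂ (Q ++ A₂))) (sym (++-assoc R A₁ _)) ⟩
  (R ++ A₁) ++ B₂ ++ Q ++ A₂    ≈⟨ ≈ʷ-++ʳ (B₂ ++ Q ++ A₂) (++-comm-distant R A₁ R⋯A₁) ⟩
  (A₁ ++ R) ++ B₂ ++ Q ++ A₂    ≡⟨ trans (++-assoc A₁ R _) (cong (λ t → A₁ ++ R ++ t) (sym (++-assoc B₂ Q A₂))) ⟩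
  A₁ ++ R ++ (B₂ ++ Q) ++ A₂    ≈⟨ ≈ʷ-++ˡ A₁ (≈ʷ-++ˡ R (≈ʷ-++ʳ A₂ (++-comm-distant B₂ Q B₂⋯Q))) ⟩
  A₁ ++ R ++ (Q ++ B₂) ++ A₂    ≡⟨ cong (λ t → A₁ ++ R ++ t) (++-assoc Q B₂ A₂) ⟩
  A₁ ++ R ++ Q ++ B₂ ++ A₂      ∎
  where
  open ≈ʷ-Reasoning
  B₂⋯A₁ : All (λ b → All (Distant b) A₁) B₂
  B₂⋯A₁ = All.map (λ s<b → All.map (λ 1+a<c → inj₂ (<-trans 1+a<c (≤-<-trans c≤s (<-trans (n<1+n s) s<b)))) A₁-low)
                  B₂-high
  R⋯A₁ : All (λ x → All (Distant x) A₁) R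
  R⋯A₁ = All.map (λ (c≤x , _) → All.map (λ a<c → inj₂ (<-≤-trans a<c c≤x)) A₁-low) R-mid
  B₂⋯Q : All (λ b → All (Distant b) Q) B₂
  B₂⋯Q = All.map (λ s<b → All.map (λ (_ , y≤s) → inj₂ (≤-<-trans (s≤s y≤s) s<b)) Q-mid) B₂-high

≈ʷ-++-assoc : ∀ p q p′ q′ r → p ++ q ≈ʷ p′ ++ q′ → p ++ q ++ r ≈ʷ p′ ++ q′ ++ r
≈ʷ-++-assoc p q p′ q′ r eq = begin
  p ++ q ++ r     ≡⟨ ++-assoc p q r ⟨
  (p ++ q) ++ r   ≈⟨ ≈ʷ-++ʳ r eq ⟩
  (p′ ++ q′) ++ r ≡⟨ ++-assoc p′ q′ r ⟩
  p′ ++ q′ ++ r   ∎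
  where open ≈ʷ-Reasoning

module _ (c k : ℕ) where

  private
    R  = consecutive c (suc k)
    R′ = consecutive (suc c) k
    Q  = consecutive c k
    c≤c+k = m≤m+n c k
    R-mid : All (Between c (c + k)) R
    R-mid = consecutive-between c (suc k) ≤-refl (≤-reflexive (+-suc c k))
    R′-mid : All (Between c (c + k)) R′
    R′-mid = consecutive-between (suc c) k (n≤1+n c) ≤-refl
    Q-mid : All (Between c (c + k)) Q
    Q-mid = consecutive-between c k ≤-refl (n≤1+n (c + k))

  raise-≈ʷ : ∀ B₁ B₂ A₁ A₂ → All (λ b → suc (c + k) < b) B₂ → All (λ a → suc a < c) A₁ →
    (B₁ ++ R ++ B₂) ++ (A₁ ++ Q ++ A₂) ≈ʷ (B₁ ++ R′ ++ B₂) ++ (A₁ ++ R ++ A₂)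
  raise-≈ʷ B₁ B₂ A₁ A₂ B₂-high A₁-low = begin
    (B₁ ++ R ++ B₂) ++ A₁ ++ Q ++ A₂  ≡⟨ ++-assoc₃ B₁ R B₂ _ ⟩
    B₁ ++ R ++ B₂ ++ A₁ ++ Q ++ A₂    ≈⟨ ≈ʷ-++ˡ B₁ (rearrange R B₂ A₁ Q A₂ c≤c+k R-mid Q-mid B₂-high A₁-low) ⟩
    B₁ ++ A₁ ++ R ++ Q ++ B₂ ++ A₂    ≈⟨ ≈ʷ-++ˡ B₁ (≈ʷ-++ˡ A₁ (≈ʷ-++-assoc R Q R′ R (B₂ ++ A₂) (consecutive-braid c k))) ⟩
    B₁ ++ A₁ ++ R′ ++ R ++ B₂ ++ A₂   ≈⟨ ≈ʷ-++ˡ B₁ (rearrange R′ B₂ A₁ R A₂ c≤c+k R′-mid R-mid B₂-high A₁-low) ⟨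
    B₁ ++ R′ ++ B₂ ++ A₁ ++ R ++ A₂   ≡⟨ ++-assoc₃ B₁ R′ B₂ _ ⟨
    (B₁ ++ R′ ++ B₂) ++ A₁ ++ R ++ A₂ ∎
    where open ≈ʷ-Reasoning

  shorten-≈ʷ : ∀ B₁ B₂ A₁ A₃ → All (λ b → suc (c + k) < b) B₂ → All (λ a → suc a < c) A₁ →
    (B₁ ++ R ++ B₂) ++ (A₁ ++ R ++ A₃) ≈ʷ B₁ ++ A₁ ++ R′ ++ Q ++ B₂ ++ A₃
  shorten-≈ʷ B₁ B₂ A₁ A₃ B₂-high A₁-low = begin
    (B₁ ++ R ++ B₂) ++ A₁ ++ R ++ A₃  ≡⟨ ++-assoc₃ B₁ R B₂ _ ⟩
    B₁ ++ R ++ B₂ ++ A₁ ++ R ++ A₃    ≈⟨ ≈ʷ-++ˡ B₁ (rearrange R B₂ A₁ R A₃ c≤c+k R-mid R-mid B₂-high A₁-low) ⟩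
    B₁ ++ A₁ ++ R ++ R ++ B₂ ++ A₃    ≈⟨ ≈ʷ-++ˡ B₁ (≈ʷ-++ˡ A₁ (≈ʷ-++-assoc R R R′ Q (B₂ ++ A₃) (consecutive-square c k))) ⟩
    B₁ ++ A₁ ++ R′ ++ Q ++ B₂ ++ A₃   ∎
    where open ≈ʷ-Reasoning

-- Inversions bound the length of any word

module _ {A : Set} where

  length-filter-∷ : ∀ {Q : Pred A 0ℓ} (Q? : Decidable Q) x xs → length (filter Q? xs) ≤ length (filter Q? (x ∷ xs))
  length-filter-∷ Q? x xs with does (Q? x)
  ... | true  = n≤1+n _
  ... | false = ≤-refl

  length-filter-⊎ : ∀ {Q R S : Pred A 0ℓ} (Q? : Decidable Q) (R? : Decidable R) (S? : Decidable S) →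
    (∀ {x} → Q x → R x ⊎ S x) → ∀ xs → length (filter Q? xs) ≤ length (filter R? xs) + length (filter S? xs)
  length-filter-⊎ Q? R? S? Q⊆R∪S []       = z≤n
  length-filter-⊎ Q? R? S? Q⊆R∪S (x ∷ xs) with ih ← length-filter-⊎ Q? R? S? Q⊆R∪S xs | Q? x
  ... | no _ = ≤-trans ih (+-mono-≤ (length-filter-∷ R? x xs) (length-filter-∷ S? x xs))
  ... | yes qx with Q⊆R∪S qx
  ...   | inj₁ rx rewrite filter-accept R? {xs = xs} rx =
    s≤s (≤-trans ih (+-monoʳ-≤ _ (length-filter-∷ S? x xs)))
  ...   | inj₂ sx rewrite filter-accept S? {xs = xs} sx | +-suc (length (filter R? (x ∷ xs))) (length (filter S? xs)) =
    s≤s (≤-trans ih (+-monoˡ-≤ _ (length-filter-∷ R? x xs)))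

  length-filter-subsingleton : ∀ {S : Pred A 0ℓ} (S? : Decidable S) → (∀ {x y} → S x → S y → x ≡ y) →
    ∀ {xs} → Unique xs → length (filter S? xs) ≤ 1
  length-filter-subsingleton S? S-unique []                 = z≤n
  length-filter-subsingleton S? S-unique {x ∷ xs} (x∉xs ∷ xs!) with S? x
  ... | yes sx rewrite filter-none S? (All.map (λ x≢y sy → x≢y (S-unique sx sy)) x∉xs) = ≤-refl
  ... | no _   = length-filter-subsingleton S? S-unique xs!

pairs : (n : ℕ) → List (Fin n × Fin n)
pairs n = cartesianProduct (allFin n) (allFin n)

Inversion : (n : ℕ) → (ℕ → ℕ) → Fin n × Fin n → Set
Inversion n g (i , j) = i F.< j × g (suc (toℕ j)) < g (suc (toℕ i))

inversion? : ∀ n g → Decidable (Inversion n g)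
inversion? n g (i , j) = (i F.<? j) ×-dec (g (suc (toℕ j)) <? g (suc (toℕ i)))

inversions : ℕ → (ℕ → ℕ) → ℕ
inversions n g = length (filter (inversion? n g) (pairs n))

sw-mono-< : ∀ x {a b} → a < b → ¬ (a ≡ x × b ≡ suc x) → sw x a < sw x b
sw-mono-< x {a} {b} a<b not-pair with a ≟ x | a ≟ suc x
... | yes refl | _ = subst₂ _<_ (sym (sw-left a)) (sym (sw-above 1+a<b)) 1+a<b
  where 1+a<b = ≤∧≢⇒< a<b (λ 1+a≡b → not-pair (refl , sym 1+a≡b))
... | no _ | yes refl rewrite sw-right x | sw-above a<b = <-trans (n<1+n x) a<b
... | no a≢x | no a≢1+x rewrite sw-fixed a≢x a≢1+x with b ≟ x | b ≟ suc x
...   | yes refl | _        rewrite sw-left b  = m<n⇒m<1+n a<b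
...   | no _     | yes refl rewrite sw-right x = ≤∧≢⇒< (s≤s⁻¹ a<b) a≢x
...   | no b≢x   | no b≢1+x rewrite sw-fixed b≢x b≢1+x = a<b

inversions-sw : ∀ n g x → (∀ {a b} → g a ≡ g b → a ≡ b) → inversions n (sw x ∘ g) ≤ suc (inversions n g)
inversions-sw n g x g-injective = begin
  inversions n (sw x ∘ g)
    ≤⟨ length-filter-⊎ _ (inversion? n g) swapped? classify (pairs n) ⟩
  inversions n g + length (filter swapped? (pairs n))
    ≤⟨ +-monoʳ-≤ _ (length-filter-subsingleton swapped? swapped-unique pairs-unique) ⟩
  inversions n g + 1
    ≡⟨ +-comm _ 1 ⟩
  suc (inversions n g)
    ∎
  where
  open ≤-Reasoning
  at : Fin n → ℕ
  at i = g (suc (toℕ i))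
  Swapped : Fin n × Fin n → Set
  Swapped (i , j) = at i ≡ x × at j ≡ suc x
  swapped? : Decidable Swapped
  swapped? (i , j) = (at i ≟ x) ×-dec (at j ≟ suc x)
  at-injective : ∀ {i j} → at i ≡ at j → i ≡ j
  at-injective = toℕ-injective ∘ suc-injective ∘ g-injective
  swapped-unique : ∀ {p q} → Swapped p → Swapped q → p ≡ q
  swapped-unique (gi , gj) (gi′ , gj′) = cong₂ _,_ (at-injective (trans gi (sym gi′))) (at-injective (trans gj (sym gj′)))
  pairs-unique : Unique (pairs n)
  pairs-unique = cartesianProduct⁺ (allFin⁺ n) (allFin⁺ n)
  classify : ∀ {p} → Inversion n (sw x ∘ g) p → Inversion n g p ⊎ Swapped p
  classify {i , j} (i<j , swapped-order) with at j <? at i | swapped? (i , j)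
  ... | yes gj<gi | _       = inj₁ (i<j , gj<gi)
  ... | no _      | yes sij = inj₂ sij
  ... | no gj≮gi  | no ¬sij = contradiction swapped-order (<⇒≯ (sw-mono-< x gi<gj ¬sij))
    where gi<gj = ≤∧≢⇒< (≮⇒≥ gj≮gi) (λ gi≡gj → <⇒≢ i<j (cong toℕ (at-injective gi≡gj)))

wordAct-injective : ∀ a {x y} → wordAct a x ≡ wordAct a y → x ≡ y
wordAct-injective []      eq = eq
wordAct-injective (b ∷ a) eq = wordAct-injective a (sw-injective b eq)

inversions-wordAct : ∀ n a → inversions n (wordAct a) ≤ length a
inversions-wordAct n []      = ≤-reflexive (cong length (filter-none _ (All.universal no-inversion (pairs n))))
  where
  no-inversion : ∀ p → ¬ Inversion n (wordAct []) p
  no-inversion _ (i<j , j<i) = <-asym i<j (s≤s⁻¹ j<i)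
inversions-wordAct n (x ∷ a) = ≤-trans (inversions-sw n (wordAct a) x (wordAct-injective a)) (s≤s (inversions-wordAct n a))

len≤length : ∀ {n} (v : Permutation′ n) a → Represents a v → len v ≤ length a
len≤length {n} v a rep = begin
  len v                     ≡⟨ cong length (filter-≐ _ (inversion? n (wordAct a)) same-inversions (pairs n)) ⟩
  inversions n (wordAct a)  ≤⟨ inversions-wordAct n a ⟩
  length a                  ∎
  where
  open ≤-Reasoning
  same-inversions =
    (λ { {i , j} (i<j , vj<vi) → i<j , subst₂ _<_ (sym (rep j)) (sym (rep i)) (s≤s vj<vi) }) ,
    (λ { {i , j} (i<j , aj<ai) → i<j , s≤s⁻¹ (subst₂ _<_ (rep j) (rep i) aj<ai) })

-- The pairing of consecutive blocks

memb-reflects : ∀ x L → Reflects (x ∈ L) (memb x L)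
memb-reflects x []       = ofⁿ λ ()
memb-reflects x (y ∷ ys) with x ≟ y
... | yes refl rewrite ≡ᵇ-true {x} refl = ofʸ (here refl)
... | no x≢y rewrite ≡ᵇ-false x≢y with memb x ys | memb-reflects x ys
...   | true  | ofʸ x∈ys = ofʸ (there x∈ys)
...   | false | ofⁿ x∉ys = ofⁿ λ { (here x≡y) → x≢y x≡y ; (there x∈ys) → x∉ys x∈ys }

∉⇒memb-false : ∀ {x L} → x ∉ L → memb x L ≡ false
∉⇒memb-false {x} {L} x∉L with memb x L | memb-reflects x L
... | false | _        = refl
... | true  | ofʸ x∈L = contradiction x∈L x∉L

removeFirstGt-< : ∀ {a b} bs → a < b → removeFirstGt a (b ∷ bs) ≡ bs
removeFirstGt-< bs a<b rewrite <ᵇ-true a<b = refl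

removeFirstGt-≮ : ∀ {a b} bs → a ≮ b → removeFirstGt a (b ∷ bs) ≡ b ∷ removeFirstGt a bs
removeFirstGt-≮ bs a≮b rewrite <ᵇ-false a≮b = refl

data RemoveFirstGt (a : ℕ) (L : List ℕ) : Set where
  none    : All (_≤ a) L → removeFirstGt a L ≡ L → RemoveFirstGt a L
  removes : ∀ L₁ x L₂ → L ≡ L₁ ++ x ∷ L₂ → removeFirstGt a L ≡ L₁ ++ L₂ → a < x → All (_≤ a) L₁ →
            RemoveFirstGt a L

removeFirstGt-view : ∀ a L → RemoveFirstGt a L
removeFirstGt-view a []       = none [] refl
removeFirstGt-view a (b ∷ bs) with a <? b
... | yes a<b = removes [] b bs refl (removeFirstGt-< bs a<b) a<b []
... | no a≮b with removeFirstGt-view a bs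
...   | none bs≤a eq = none (≮⇒≥ a≮b ∷ bs≤a) (trans (removeFirstGt-≮ bs a≮b) (cong (b ∷_) eq))
...   | removes L₁ x L₂ refl eq a<x L₁≤a =
  removes (b ∷ L₁) x L₂ refl (trans (removeFirstGt-≮ bs a≮b) (cong (b ∷_) eq)) a<x (≮⇒≥ a≮b ∷ L₁≤a)

removeFirstGt-⊆ : ∀ a L {y} → y ∈ removeFirstGt a L → y ∈ L
removeFirstGt-⊆ a L y∈ with removeFirstGt-view a L
... | none _ eq = subst (_ ∈_) eq y∈
... | removes L₁ x L₂ refl eq _ _ with ∈-++⁻ L₁ (subst (_ ∈_) eq y∈)
...   | inj₁ y∈L₁ = ∈-++⁺ˡ y∈L₁
...   | inj₂ y∈L₂ = ∈-++⁺ʳ L₁ (there y∈L₂)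

removeFirstGt-increasing : ∀ a {L} → Increasing L → Increasing (removeFirstGt a L)
removeFirstGt-increasing a {L} inc with removeFirstGt-view a L
... | none _ eq                 = subst Increasing (sym eq) inc
... | removes L₁ x L₂ refl eq _ _ = subst Increasing (sym eq) (AllPairs-delete L₁ inc)

unpairedFrom-⊆ : ∀ as L {y} → y ∈ unpairedFrom as L → y ∈ L
unpairedFrom-⊆ []       L y∈ = y∈
unpairedFrom-⊆ (a ∷ as) L y∈ = removeFirstGt-⊆ a L (unpairedFrom-⊆ as (removeFirstGt a L) y∈)

unpairedFrom-increasing : ∀ as {L} → Increasing L → Increasing (unpairedFrom as L)
unpairedFrom-increasing []       inc = inc
unpairedFrom-increasing (a ∷ as) inc = unpairedFrom-increasing as (removeFirstGt-increasing a inc)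

unpairedFrom-++ : ∀ xs ys L → unpairedFrom (xs ++ ys) L ≡ unpairedFrom ys (unpairedFrom xs L)
unpairedFrom-++ []       ys L = refl
unpairedFrom-++ (x ∷ xs) ys L = unpairedFrom-++ xs ys _

InRange : ℕ → ℕ → ℕ → Set
InRange p q x = p ≤ x × x < q

inRange? : ∀ p q → Decidable (InRange p q)
inRange? p q x = (p ≤? x) ×-dec (x <? q)

countIn : ℕ → ℕ → List ℕ → ℕ
countIn p q xs = length (filter (inRange? p q) xs)

countIn-++ : ∀ p q xs ys → countIn p q (xs ++ ys) ≡ countIn p q xs + countIn p q ys
countIn-++ p q xs ys = trans (cong length (filter-++ (inRange? p q) xs ys)) (length-++ (filter (inRange? p q) xs))

countIn-∷ : ∀ p q x xs → countIn p q (x ∷ xs) ≤ suc (countIn p q xs)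
countIn-∷ p q x xs with does (inRange? p q x)
... | true  = ≤-refl
... | false = n≤1+n _

countIn-∷-out : ∀ {p q x} xs → ¬ InRange p q x → countIn p q (x ∷ xs) ≡ countIn p q xs
countIn-∷-out {p} {q} xs ¬in = cong length (filter-reject (inRange? p q) {xs = xs} ¬in)

countIn-∷-in : ∀ {p q x} xs → InRange p q x → countIn p q (x ∷ xs) ≡ suc (countIn p q xs)
countIn-∷-in {p} {q} xs in-x = cong length (filter-accept (inRange? p q) {xs = xs} in-x)

countIn-delete : ∀ p q xs y ys → countIn p q (xs ++ y ∷ ys) ≤ suc (countIn p q (xs ++ ys))
countIn-delete p q xs y ys rewrite countIn-++ p q xs (y ∷ ys) | countIn-++ p q xs ys =
  ≤-trans (+-monoʳ-≤ (countIn p q xs) (countIn-∷ p q y ys)) (≤-reflexive (+-suc _ _))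

countIn-delete-out : ∀ {p q} xs {y} ys → ¬ InRange p q y → countIn p q (xs ++ y ∷ ys) ≡ countIn p q (xs ++ ys)
countIn-delete-out {p} {q} xs {y} ys ¬in =
  trans (countIn-++ p q xs (y ∷ ys))
        (trans (cong (countIn p q xs +_) (countIn-∷-out ys ¬in)) (sym (countIn-++ p q xs ys)))

countIn-none : ∀ {p q xs} → All (¬_ ∘ InRange p q) xs → countIn p q xs ≡ 0
countIn-none {p} {q} out = cong length (filter-none (inRange? p q) out)

countIn-reverse : ∀ p q xs → countIn p q (reverse xs) ≡ countIn p q xs
countIn-reverse p q xs = ↭-length (filter-↭ (inRange? p q) (↭-reverse xs))

countIn-∉ : ∀ p q {xs} → q ∉ xs → countIn p (suc q) xs ≡ countIn p q xs
countIn-∉ p q {[]}     _   = refl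
countIn-∉ p q {x ∷ xs} q∉ with ih ← countIn-∉ p q (q∉ ∘ there) | inRange? p (suc q) x | inRange? p q x
... | yes in₁ | yes in₂ = trans (countIn-∷-in xs in₁) (trans (cong suc ih) (sym (countIn-∷-in xs in₂)))
... | no out₁ | no out₂ = trans (countIn-∷-out xs out₁) (trans ih (sym (countIn-∷-out xs out₂)))
... | yes (p≤x , x≤q) | no ¬in = contradiction (p≤x , ≤∧≢⇒< (s≤s⁻¹ x≤q) (q∉ ∘ here ∘ sym)) ¬in
... | no ¬in | yes (p≤x , x<q) = contradiction (p≤x , m<n⇒m<1+n x<q) ¬in

length-increasing-in-range : ∀ {p q xs} → Increasing xs → All (InRange p q) xs → length xs ≤ q ∸ p
length-increasing-in-range []               []                  = z≤n
length-increasing-in-range {p} {q} {x ∷ xs} (x<xs ∷ inc) ((p≤x , x<q) ∷ in-xs) = begin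
  suc (length xs)  ≤⟨ s≤s (length-increasing-in-range inc (All.zipWith (λ (x<y , _ , y<q) → x<y , y<q) (x<xs , in-xs))) ⟩
  suc (q ∸ suc x)  ≡⟨ +-∸-assoc 1 x<q ⟨
  q ∸ x            ≤⟨ ∸-monoʳ-≤ q p≤x ⟩
  q ∸ p            ∎
  where open ≤-Reasoning

countIn-increasing : ∀ p q {xs} → Increasing xs → countIn p q xs ≤ q ∸ p
countIn-increasing p q {xs} inc =
  length-increasing-in-range (AllPairs.filter⁺ (inRange? p q) inc) (All.all-filter (inRange? p q) xs)

countIn-consecutive : ∀ p k → countIn p (p + k) (consecutive p k) ≡ k
countIn-consecutive p k =
  trans (cong length (filter-all (inRange? p (p + k)) (All.zip (consecutive-≥ p k , consecutive-< p k))))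
        (length-consecutive p k)

countIn-≥-consecutive : ∀ p k {L} → Increasing L → (∀ j → j < k → p + j ∈ L) → k ≤ countIn p (p + k) L
countIn-≥-consecutive p k inc ∈L with consecutive-split p k inc ∈L
... | L₁ , L₂ , refl , _ = begin
  k                                         ≡⟨ countIn-consecutive p k ⟨
  countIn p (p + k) (consecutive p k)       ≤⟨ m≤m+n _ _ ⟩
  countIn p (p + k) (consecutive p k) + countIn p (p + k) L₂   ≡⟨ countIn-++ p (p + k) (consecutive p k) L₂ ⟨
  countIn p (p + k) (consecutive p k ++ L₂) ≤⟨ m≤n+m _ _ ⟩
  countIn p (p + k) L₁ + countIn p (p + k) (consecutive p k ++ L₂) ≡⟨ countIn-++ p (p + k) L₁ _ ⟨
  countIn p (p + k) (L₁ ++ consecutive p k ++ L₂) ∎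
  where open ≤-Reasoning

countIn-removeFirstGt : ∀ p q a L → countIn p q L ≤ suc (countIn p q (removeFirstGt a L))
countIn-removeFirstGt p q a L with removeFirstGt-view a L
... | none _ eq                   = subst (λ M → countIn p q L ≤ suc (countIn p q M)) (sym eq) (n≤1+n _)
... | removes L₁ x L₂ refl eq _ _ = subst (λ M → countIn p q L ≤ suc (countIn p q M)) (sym eq) (countIn-delete p q L₁ x L₂)

countIn-removeFirstGt-≥ : ∀ p q a L → q ≤ suc a → countIn p q (removeFirstGt a L) ≡ countIn p q L
countIn-removeFirstGt-≥ p q a L q≤1+a with removeFirstGt-view a L
... | none _ eq                     = cong (countIn p q) eq
... | removes L₁ x L₂ refl eq a<x _ =
  trans (cong (countIn p q) eq) (sym (countIn-delete-out L₁ L₂ λ (_ , x<q) → <⇒≱ x<q (≤-trans q≤1+a a<x)))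

countIn-removeFirstGt-< : ∀ p q a {v L} → Increasing L → v ∈ L → a < v → v < p →
  countIn p q (removeFirstGt a L) ≡ countIn p q L
countIn-removeFirstGt-< p q a {v} {L} inc v∈L a<v v<p with removeFirstGt-view a L
... | none _ eq                      = cong (countIn p q) eq
... | removes L₁ x L₂ refl eq _ L₁≤a =
  trans (cong (countIn p q) eq) (sym (countIn-delete-out L₁ L₂ λ (p≤x , _) → <⇒≱ v<p (≤-trans p≤x x≤v)))
  where
  x≤v : x ≤ v
  x≤v with ∈-++⁻ L₁ v∈L
  ... | inj₁ v∈L₁          = contradiction (All.lookup L₁≤a v∈L₁) (<⇒≱ a<v)
  ... | inj₂ (here refl)   = ≤-refl
  ... | inj₂ (there v∈L₂) = <⇒≤ (All.lookup (AllPairs-middle L₁ inc) v∈L₂)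

countIn-unpairedFrom : ∀ t as L → countIn 0 (suc t) L ≤ countIn 0 (suc t) (unpairedFrom as L) + countIn 0 t as
countIn-unpairedFrom t []       L = ≤-reflexive (sym (+-identityʳ _))
countIn-unpairedFrom t (a ∷ as) L with inRange? 0 t a
... | yes in-a = begin
  # L                                ≤⟨ countIn-removeFirstGt 0 (suc t) a L ⟩
  suc (# (removeFirstGt a L))        ≤⟨ s≤s (countIn-unpairedFrom t as _) ⟩
  suc (#U + countIn 0 t as)          ≡⟨ +-suc _ _ ⟨
  #U + suc (countIn 0 t as)          ≡⟨ cong (#U +_) (countIn-∷-in as in-a) ⟨
  #U + countIn 0 t (a ∷ as)          ∎
  where
  open ≤-Reasoning
  # = countIn 0 (suc t)
  #U = # (unpairedFrom (a ∷ as) L)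
... | no out-a = begin
  # L                                ≡⟨ countIn-removeFirstGt-≥ 0 (suc t) a L (s≤s (≮⇒≥ (out-a ∘ (z≤n ,_)))) ⟨
  # (removeFirstGt a L)              ≤⟨ countIn-unpairedFrom t as _ ⟩
  #U + countIn 0 t as                ≡⟨ cong (#U +_) (countIn-∷-out as out-a) ⟨
  #U + countIn 0 t (a ∷ as)          ∎
  where
  open ≤-Reasoning
  # = countIn 0 (suc t)
  #U = # (unpairedFrom (a ∷ as) L)

countIn-unpairedFrom-> : ∀ v t as {L} → Increasing L → v ∈ unpairedFrom as L →
  countIn (suc v) (suc t) L ≤ countIn (suc v) (suc t) (unpairedFrom as L) + countIn v t as
countIn-unpairedFrom-> v t []       inc v∈U = ≤-reflexive (sym (+-identityʳ _))
countIn-unpairedFrom-> v t (a ∷ as) {L} inc v∈U with inRange? v t a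
... | yes in-a = begin
  # L                                      ≤⟨ countIn-removeFirstGt (suc v) (suc t) a L ⟩
  suc (# (removeFirstGt a L))              ≤⟨ s≤s (countIn-unpairedFrom-> v t as (removeFirstGt-increasing a inc) v∈U) ⟩
  suc (#U + countIn v t as)                ≡⟨ +-suc _ _ ⟨
  #U + suc (countIn v t as)                ≡⟨ cong (#U +_) (countIn-∷-in as in-a) ⟨
  #U + countIn v t (a ∷ as)                ∎
  where
  open ≤-Reasoning
  # = countIn (suc v) (suc t)
  #U = # (unpairedFrom (a ∷ as) L)
... | no out-a = begin
  # L                                      ≡⟨ unaffected ⟨
  # (removeFirstGt a L)                    ≤⟨ countIn-unpairedFrom-> v t as (removeFirstGt-increasing a inc) v∈U ⟩
  #U + countIn v t as                      ≡⟨ cong (#U +_) (countIn-∷-out as out-a) ⟨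
  #U + countIn v t (a ∷ as)                ∎
  where
  open ≤-Reasoning
  # = countIn (suc v) (suc t)
  #U = # (unpairedFrom (a ∷ as) L)
  unaffected : # (removeFirstGt a L) ≡ # L
  unaffected with a <? v
  ... | yes a<v = countIn-removeFirstGt-< (suc v) (suc t) a inc
                    (removeFirstGt-⊆ a L (unpairedFrom-⊆ as _ v∈U)) a<v (n<1+n v)
  ... | no a≮v  = countIn-removeFirstGt-≥ (suc v) (suc t) a L (s≤s (≮⇒≥ (out-a ∘ (≮⇒≥ a≮v ,_))))

-- B can sit on top of A as the next row of a tableau.
ColumnStrict : List ℕ → List ℕ → Set
ColumnStrict A B = Prefix _>_ B A

countIn-head : ∀ b bs → 1 ≤ countIn 0 (suc b) (b ∷ bs)
countIn-head b bs = ≤-trans (s≤s z≤n) (≤-reflexive (sym (countIn-∷-in {0} {suc b} bs (z≤n , ≤-refl))))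

countIn-below-head : ∀ {t x xs} → Increasing (x ∷ xs) → t ≤ x → countIn 0 t (x ∷ xs) ≡ 0
countIn-below-head {t} inc t≤x = countIn-none {0} {t} (All.map (λ t≤y (_ , y<t) → <⇒≱ y<t t≤y) (increasing-≥ inc t≤x))

columnStrict-or-excess : ∀ {A B} → Increasing A → Increasing B →
  ColumnStrict A B ⊎ ∃ λ t → suc (countIn 0 t A) ≤ countIn 0 (suc t) B
columnStrict-or-excess {A}      {[]}     _ _ = inj₁ []
columnStrict-or-excess {[]}     {b ∷ bs} _ _ = inj₂ (b , countIn-head b bs)
columnStrict-or-excess {a ∷ as} {b ∷ bs} incA@(_ ∷ incas) incB@(b<bs ∷ incbs) with a <? b
... | no a≮b = inj₂ (b , subst (λ c → suc c ≤ _) (sym (countIn-below-head incA (≮⇒≥ a≮b))) (countIn-head b bs))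
... | yes a<b with columnStrict-or-excess incas incbs
...   | inj₁ strict = inj₁ (a<b ∷ strict)
...   | inj₂ (t , excess) with b ≤? t
...     | yes b≤t = inj₂ (t , (begin
  suc (countIn 0 t (a ∷ as))           ≤⟨ s≤s (countIn-∷ 0 t a as) ⟩
  suc (suc (countIn 0 t as))           ≤⟨ s≤s excess ⟩
  suc (countIn 0 (suc t) bs)           ≡⟨ countIn-∷-in bs (z≤n , s≤s b≤t) ⟨
  countIn 0 (suc t) (b ∷ bs)           ∎))
  where open ≤-Reasoning
...     | no b≰t = contradiction (subst (suc _ ≤_) (countIn-none {0} {suc t} bs-out) excess) λ ()
  where
  bs-out : All (¬_ ∘ InRange 0 (suc t)) bs
  bs-out = All.map (λ b<y (_ , y≤t) → b≰t (<⇒≤ (<-≤-trans b<y (s≤s⁻¹ y≤t)))) b<bs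

allPaired⇒columnStrict : ∀ {A B} → Increasing A → Increasing B → unpairedFrom (reverse A) B ≡ [] → ColumnStrict A B
allPaired⇒columnStrict {A} {B} incA incB all-paired with columnStrict-or-excess incA incB
... | inj₁ strict = strict
... | inj₂ (t , excess) = contradiction excess (<⇒≱ (s≤s (begin
  countIn 0 (suc t) B
    ≤⟨ countIn-unpairedFrom t (reverse A) B ⟩
  countIn 0 (suc t) (unpairedFrom (reverse A) B) + countIn 0 t (reverse A)
    ≡⟨ cong₂ _+_ (cong (countIn 0 (suc t)) all-paired) (countIn-reverse 0 t A) ⟩
  countIn 0 t A
    ∎)))
  where open ≤-Reasoning

removeFirstGt-suc∉ : ∀ w {M} → Increasing M → suc w ∉ removeFirstGt w M
removeFirstGt-suc∉ w {M} inc 1+w∈ with removeFirstGt-view w M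
... | none M≤w eq = contradiction (All.lookup M≤w (subst (suc w ∈_) eq 1+w∈)) (n≮n w)
... | removes L₁ x L₂ refl eq w<x L₁≤w with ∈-++⁻ L₁ (subst (suc w ∈_) eq 1+w∈)
...   | inj₁ 1+w∈L₁ = contradiction (All.lookup L₁≤w 1+w∈L₁) (<⇒≱ ≤-refl)
...   | inj₂ 1+w∈L₂ = contradiction (All.lookup (AllPairs-middle L₁ inc) 1+w∈L₂) (≤⇒≯ w<x)

unpaired-suc⇒∉ : ∀ {A B w} → Increasing B → suc w ∈ unpairedFrom (reverse A) B → w ∉ A
unpaired-suc⇒∉ {A} {B} {w} incB 1+w∈U w∈A with ∈-∃++ (reverse⁺ w∈A)
... | ys , zs , eq = removeFirstGt-suc∉ w (unpairedFrom-increasing ys incB) (unpairedFrom-⊆ zs _ 1+w∈U′)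
  where
  1+w∈U′ : suc w ∈ unpairedFrom zs (removeFirstGt w (unpairedFrom ys B))
  1+w∈U′ = subst (suc w ∈_) (trans (cong (λ as → unpairedFrom as B) eq) (unpairedFrom-++ ys (w ∷ zs) B)) 1+w∈U

-- B has m + 1 letters in (v, v + m + 1]; each is paired with a letter of A in [v, v + m], and
-- without v + m there are at most m of those.
maxUnpaired-∈ : ∀ {A B v} m → Increasing A → Increasing B →
  v ∈ unpairedFrom (reverse A) B → All (_≤ v) (unpairedFrom (reverse A) B) →
  (∀ j → j < suc m → suc v + j ∈ B) → v + m ∈ A
maxUnpaired-∈ {A} {B} {v} m incA incB v∈U U≤v ∈B with v + m ∈? A
... | yes v+m∈A = v+m∈A
... | no v+m∉A  = contradiction (begin
  suc m                                      ≤⟨ countIn-≥-consecutive (suc v) (suc m) incB ∈B ⟩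
  countIn (suc v) (suc v + suc m) B          ≡⟨ cong (λ t → countIn (suc v) t B) (cong suc (+-suc v m)) ⟩
  countIn (suc v) (suc t) B                  ≤⟨ countIn-unpairedFrom-> v t (reverse A) incB v∈U ⟩
  countIn (suc v) (suc t) U + countIn v t (reverse A) ≡⟨ cong₂ _+_ (countIn-none U-out) (countIn-reverse v t A) ⟩
  countIn v (suc (v + m)) A                  ≡⟨ countIn-∉ v (v + m) v+m∉A ⟩
  countIn v (v + m) A                        ≤⟨ countIn-increasing v (v + m) incA ⟩
  v + m ∸ v                                  ≡⟨ m+n∸m≡n v m ⟩
  m                                          ∎) (n≮n m)
  where
  open ≤-Reasoning
  t = suc (v + m)
  U = unpairedFrom (reverse A) B
  U-out : All (¬_ ∘ InRange (suc v) (suc t)) U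
  U-out = All.map (λ y≤v (v<y , _) → <⇒≱ v<y y≤v) U≤v

findS-spec : ∀ f B z → ∃ λ k → findS f B z ≡ z + k × (∀ j → j < k → suc z + j ∈ B) × (suc (z + k) ∉ B ⊎ k ≡ f)
findS-spec zero    B z = 0 , sym (+-identityʳ z) , (λ _ ()) , inj₂ refl
findS-spec (suc f) B z with memb (suc z) B | memb-reflects (suc z) B
... | false | ofⁿ 1+z∉B = 0 , sym (+-identityʳ z) , (λ _ ()) , inj₁ (subst (λ t → suc t ∉ B) (sym (+-identityʳ z)) 1+z∉B)
... | true  | ofʸ 1+z∈B with findS-spec f B (suc z)
...   | k , eq , run , stop =
  suc k , trans eq (sym (+-suc z k)) , run′ , Sum.map (subst (λ t → suc t ∉ B) (sym (+-suc z k))) (cong suc) stop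
  where
  run′ : ∀ j → j < suc k → suc z + j ∈ B
  run′ zero    _         = subst (_∈ B) (sym (+-identityʳ (suc z))) 1+z∈B
  run′ (suc j) (s≤s j<k) = subst (_∈ B) (sym (+-suc (suc z) j)) (run j j<k)

findS-consecutive : ∀ {B} z → Increasing B →
  ∃ λ k → findS (suc (length B)) B z ≡ z + k × (∀ j → j < k → suc z + j ∈ B) × suc (z + k) ∉ B
findS-consecutive {B} z incB with findS-spec (suc (length B)) B z
... | k , eq , run , inj₁ stop = k , eq , run , stop
... | k , eq , run , inj₂ refl = contradiction (begin
  suc (length B)                                  ≤⟨ countIn-≥-consecutive (suc z) k incB run ⟩
  countIn (suc z) (suc z + k) B                   ≤⟨ length-filter (inRange? (suc z) (suc z + k)) B ⟩
  length B                                        ∎) (n≮n (length B))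
  where open ≤-Reasoning

-- Edelman–Greene insertion of column-strict rows

allLe-true : ∀ {x} D → All (_≤ x) D → allLe D x ≡ true
allLe-true []      []           = refl
allLe-true (d ∷ D) (d≤x ∷ D≤x) rewrite <ᵇ-true (s≤s d≤x) = allLe-true D D≤x

allLe-false : ∀ {x b} D bs → All (_≤ x) D → x < b → allLe (D ++ b ∷ bs) x ≡ false
allLe-false []      bs []           x<b rewrite <ᵇ-false (<⇒≱ x<b ∘ s≤s⁻¹) = refl
allLe-false (d ∷ D) bs (d≤x ∷ D≤x) x<b rewrite <ᵇ-true (s≤s d≤x) = allLe-false D bs D≤x x<b

firstGt-++ : ∀ {x b d} D bs → All (_≤ x) D → x < b → firstGt x (D ++ b ∷ bs) d ≡ b
firstGt-++ []      bs []           x<b rewrite <ᵇ-true x<b = refl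
firstGt-++ (e ∷ D) bs (e≤x ∷ D≤x) x<b rewrite <ᵇ-false (≤⇒≯ e≤x) = firstGt-++ D bs D≤x x<b

replaceFirst-++ : ∀ {a b} D bs → All (_< b) D → replaceFirst b a (D ++ b ∷ bs) ≡ D ++ a ∷ bs
replaceFirst-++ {b = b} []      bs []           rewrite ≡ᵇ-true {b} refl = refl
replaceFirst-++         (d ∷ D) bs (d<b ∷ D<b) rewrite ≡ᵇ-false (<⇒≢ d<b) = cong (d ∷_) (replaceFirst-++ D bs D<b)

insRow-append : ∀ {a} D → All (_≤ a) D → insRow a D ≡ (D ∷ʳ a , nothing)
insRow-append D D≤a rewrite allLe-true D D≤a = refl

∉-around : ∀ {a b} D bs → All (_< a) D → a < b → All (b <_) bs → a ∉ D ++ b ∷ bs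
∉-around {a} D bs D<a a<b b<bs a∈ with ∈-++⁻ D a∈
... | inj₁ a∈D          = n≮n a (All.lookup D<a a∈D)
... | inj₂ (here refl)   = n≮n a a<b
... | inj₂ (there a∈bs) = n≮n a (<-trans a<b (All.lookup b<bs a∈bs))

insRow-bump : ∀ {a b} D bs → All (_< a) D → a < b → All (b <_) bs → insRow a (D ++ b ∷ bs) ≡ (D ++ a ∷ bs , just b)
insRow-bump {a} {b} D bs D<a a<b b<bs
  rewrite allLe-false D bs (All.map <⇒≤ D<a) a<b | firstGt-++ {d = a} D bs (All.map <⇒≤ D<a) a<b
        | ∉⇒memb-false (∉-around D bs D<a a<b b<bs) | ∧-zeroʳ (b ≡ᵇ suc a)
        | replaceFirst-++ {a} D bs (All.map (λ d<a → <-trans d<a a<b) D<a) = refl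

insertWord-append : ∀ D A Ts → Increasing (D ++ A) → insertWord A (D ∷ Ts) ≡ (D ++ A) ∷ Ts
insertWord-append D []       Ts _   = cong (_∷ Ts) (sym (++-identityʳ D))
insertWord-append D (a ∷ as) Ts inc rewrite insRow-append D (All.map <⇒≤ (increasing-before D inc)) =
  trans (insertWord-append (D ∷ʳ a) as Ts (subst Increasing (sym (++-assoc D (a ∷ []) as)) inc))
        (cong (_∷ Ts) (++-assoc D (a ∷ []) as))

insertWord-row : ∀ D {A B} Ts → Increasing (D ++ A) → Increasing B → ColumnStrict A B →
  insertWord A ((D ++ B) ∷ Ts) ≡ (D ++ A) ∷ insertWord B Ts
insertWord-row D {A} {[]} Ts inc _ _ rewrite ++-identityʳ D = insertWord-append D A Ts inc
insertWord-row D {a ∷ as} {b ∷ bs} Ts inc (b<bs ∷ incB) (a<b ∷ strict)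
  rewrite insRow-bump D bs (increasing-before D inc) a<b b<bs =
  begin
    insertWord as ((D ++ a ∷ bs) ∷ egInsert b Ts)
      ≡⟨ cong (λ R → insertWord as (R ∷ egInsert b Ts)) (++-assoc D (a ∷ []) bs) ⟨
    insertWord as (((D ∷ʳ a) ++ bs) ∷ egInsert b Ts)
      ≡⟨ insertWord-row (D ∷ʳ a) (egInsert b Ts) inc′ incB strict ⟩
    ((D ∷ʳ a) ++ as) ∷ insertWord bs (egInsert b Ts)
      ≡⟨ cong (_∷ _) (++-assoc D (a ∷ []) as) ⟩
    (D ++ a ∷ as) ∷ insertWord bs (egInsert b Ts)
      ∎
  where
  open ≡-Reasoning
  inc′ = subst Increasing (sym (++-assoc D (a ∷ []) as)) inc

headRow : List (List ℕ) → List ℕ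
headRow []      = []
headRow (R ∷ _) = R

infixr 5 _∷⟨_⟩_

data IsTableau : List (List ℕ) → Set where
  []  : IsTableau []
  _∷⟨_⟩_ : ∀ {a as T} → Increasing (a ∷ as) → ColumnStrict (a ∷ as) (headRow T) → IsTableau T →
           IsTableau ((a ∷ as) ∷ T)

insertWord-tableau : ∀ {R T} → IsTableau (R ∷ T) → insertWord R T ≡ R ∷ T
insertWord-tableau {a ∷ as} {[]}    (inc ∷⟨ _ ⟩ [])                   = insertWord-append (a ∷ []) as [] inc
insertWord-tableau {R}      {S ∷ T} (incR ∷⟨ strict ⟩ tab@(incS ∷⟨ _ ⟩ _)) =
  trans (insertWord-row [] T incR incS strict) (cong (R ∷_) (insertWord-tableau tab))

takeNonEmpty : List (List ℕ) → List (List ℕ)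
takeNonEmpty []            = []
takeNonEmpty ([] ∷ _)      = []
takeNonEmpty ((x ∷ xs) ∷ T) = (x ∷ xs) ∷ takeNonEmpty T

takeNonEmpty-tableau : ∀ {r} → All Increasing r → Linked ColumnStrict r → IsTableau (takeNonEmpty r)
takeNonEmpty-tableau {[]}                 _            _   = []
takeNonEmpty-tableau {[] ∷ _}             _            _   = []
takeNonEmpty-tableau {(x ∷ xs) ∷ []}      (inc ∷ _)    _   = inc ∷⟨ [] ⟩ []
takeNonEmpty-tableau {(x ∷ xs) ∷ [] ∷ T}  (inc ∷ incs) (_ ∷ strict) = inc ∷⟨ [] ⟩ takeNonEmpty-tableau incs strict
takeNonEmpty-tableau {(x ∷ xs) ∷ (y ∷ ys) ∷ T} (inc ∷ incs) (xs<ys ∷ strict) =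
  inc ∷⟨ xs<ys ⟩ takeNonEmpty-tableau incs strict

empty-after-empty : ∀ {T} → Linked ColumnStrict ([] ∷ T) → All (_≡ []) T
empty-after-empty {[]}    _         = []
empty-after-empty {S ∷ T} ([] ∷ l) = refl ∷ empty-after-empty l

word-∷ : ∀ R T → word (R ∷ T) ≡ word T ++ R
word-∷ R T = begin
  concat (reverse (R ∷ T))       ≡⟨ cong concat (unfold-reverse R T) ⟩
  concat (reverse T ∷ʳ R)        ≡⟨ concat-++ (reverse T) (R ∷ []) ⟨
  word T ++ concat (R ∷ [])      ≡⟨ cong (word T ++_) (++-identityʳ R) ⟩
  word T ++ R                    ∎
  where open ≡-Reasoning

word-empty : ∀ {T} → All (_≡ []) T → word T ≡ []
word-empty {[]}    []           = refl
word-empty {R ∷ T} (refl ∷ Es) = trans (word-∷ [] T) (trans (++-identityʳ (word T)) (word-empty Es))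

blk-empty : ∀ {T} → All (_≡ []) T → ∀ i → blk T i ≡ []
blk-empty []           i             = refl
blk-empty (_ ∷ _)      zero          = refl
blk-empty (refl ∷ _)   (suc zero)    = refl
blk-empty (_ ∷ Es)     (suc (suc i)) = blk-empty Es (suc i)

insertWord-++ : ∀ xs ys T → insertWord (xs ++ ys) T ≡ insertWord ys (insertWord xs T)
insertWord-++ []       ys T = refl
insertWord-++ (x ∷ xs) ys T = insertWord-++ xs ys (egInsert x T)

P-word : ∀ {r} → All Increasing r → Linked ColumnStrict r → P (word r) ≡ takeNonEmpty r
P-word {[]}           _            _      = refl
P-word {[] ∷ T}       _            strict =
  cong P (trans (word-∷ [] T) (trans (++-identityʳ (word T)) (word-empty (empty-after-empty strict))))
P-word {R@(_ ∷ _) ∷ T} incs@(_ ∷ incT) strict = begin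
  P (word (R ∷ T))                ≡⟨ cong P (word-∷ R T) ⟩
  insertWord (word T ++ R) []     ≡⟨ insertWord-++ (word T) R [] ⟩
  insertWord R (P (word T))       ≡⟨ cong (insertWord R) (P-word incT (Linked.tail strict)) ⟩
  insertWord R (takeNonEmpty T)   ≡⟨ insertWord-tableau (takeNonEmpty-tableau incs strict) ⟩
  R ∷ takeNonEmpty T              ∎
  where open ≡-Reasoning

blk-takeNonEmpty : ∀ {r} → Linked ColumnStrict r → ∀ i → blk (takeNonEmpty r) i ≡ blk r i
blk-takeNonEmpty {[]}           _      i             = refl
blk-takeNonEmpty {[] ∷ T}       strict zero          = refl
blk-takeNonEmpty {[] ∷ T}       strict (suc zero)    = refl
blk-takeNonEmpty {[] ∷ T}       strict (suc (suc i)) = sym (blk-empty (empty-after-empty strict) (suc i))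
blk-takeNonEmpty {(_ ∷ _) ∷ T}  strict zero          = refl
blk-takeNonEmpty {(_ ∷ _) ∷ T}  strict (suc zero)    = refl
blk-takeNonEmpty {(_ ∷ _) ∷ []} strict (suc (suc i)) = refl
blk-takeNonEmpty {(_ ∷ _) ∷ S ∷ T} (_ ∷ strict) (suc (suc i)) = blk-takeNonEmpty strict (suc i)

P-word-rows : ∀ {r} → All Increasing r → Linked ColumnStrict r → ∀ i → row (P (word r)) i ≡ blk r i
P-word-rows incs strict i = trans (cong (λ T → blk T i) (P-word incs strict)) (blk-takeNonEmpty strict i)

Letter : ℕ → ℕ → Set
Letter n x = 1 ≤ x × x ≤ n ∸ 1

ValidBlock : ℕ → List ℕ → Set
ValidBlock i X = Linked _<_ X × CutoffOK i X

blk-at : ∀ (pre : Fact) {A} rest → blk (pre ++ A ∷ rest) (suc (length pre)) ≡ A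
blk-at []        rest = refl
blk-at (_ ∷ pre) rest = blk-at pre rest

blk-at-suc : ∀ (pre : Fact) {A B} post → blk (pre ++ A ∷ B ∷ post) (suc (suc (length pre))) ≡ B
blk-at-suc []        post = refl
blk-at-suc (_ ∷ pre) post = blk-at-suc pre post

blk-elsewhere : ∀ (pre : Fact) {A B A′ B′} post j → j ≢ suc (length pre) → j ≢ suc (suc (length pre)) →
  blk (pre ++ A′ ∷ B′ ∷ post) j ≡ blk (pre ++ A ∷ B ∷ post) j
blk-elsewhere []        post zero                j≢i _    = refl
blk-elsewhere []        post (suc zero)          j≢i _    = contradiction refl j≢i
blk-elsewhere []        post (suc (suc zero))    _   j≢1+i = contradiction refl j≢1+i
blk-elsewhere []        post (suc (suc (suc j))) _   _    = refl
blk-elsewhere (_ ∷ pre) post zero                _   _    = refl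
blk-elsewhere (_ ∷ pre) post (suc zero)          _   _    = refl
blk-elsewhere (_ ∷ pre) post (suc (suc j)) j≢i j≢1+i =
  blk-elsewhere pre post (suc j) (j≢i ∘ cong suc) (j≢1+i ∘ cong suc)

setBlk-at : ∀ (pre : Fact) {A} X rest → setBlk (suc (length pre)) X (pre ++ A ∷ rest) ≡ pre ++ X ∷ rest
setBlk-at []        X rest = refl
setBlk-at (R ∷ pre) X rest = cong (R ∷_) (setBlk-at pre X rest)

setBlk-at-suc : ∀ (pre : Fact) {A B} Y post → setBlk (suc (suc (length pre))) Y (pre ++ A ∷ B ∷ post) ≡ pre ++ A ∷ Y ∷ post
setBlk-at-suc []        Y post = refl
setBlk-at-suc (R ∷ pre) Y post = cong (R ∷_) (setBlk-at-suc pre Y post)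

word-++ : ∀ r s → word (r ++ s) ≡ word s ++ word r
word-++ r s = trans (cong concat (reverse-++ r s)) (sym (concat-++ (reverse s) (reverse r)))

word-split : ∀ pre A B post → word (pre ++ A ∷ B ∷ post) ≡ word post ++ (B ++ A) ++ word pre
word-split pre A B post = begin
  word (pre ++ A ∷ B ∷ post)                   ≡⟨ word-++ pre (A ∷ B ∷ post) ⟩
  word (A ∷ B ∷ post) ++ word pre             ≡⟨ cong (_++ word pre) (word-++ (A ∷ B ∷ []) post) ⟩
  (word post ++ B ++ A ++ []) ++ word pre      ≡⟨ cong (λ X → (word post ++ B ++ X) ++ word pre) (++-identityʳ A) ⟩
  (word post ++ B ++ A) ++ word pre            ≡⟨ ++-assoc (word post) (B ++ A) (word pre) ⟩
  word post ++ (B ++ A) ++ word pre            ∎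
  where
  open ≡-Reasoning
  open Data.List.Properties using (++-identityʳ)

split-at : ∀ i₀ (r : Fact) → suc (suc i₀) ≤ length r →
  ∃ λ pre → ∃ λ A → ∃ λ B → ∃ λ post → r ≡ pre ++ A ∷ B ∷ post × length pre ≡ i₀
split-at zero     (A ∷ B ∷ post) _       = [] , A , B , post , refl , refl
split-at zero     (A ∷ [])       (s≤s ())
split-at (suc i₀) (R ∷ r)        (s≤s h) with split-at i₀ r h
... | pre , A , B , post , refl , refl = R ∷ pre , A , B , post , refl , refl

≈ʷ-represents : ∀ {n} {v : Permutation′ n} {a b} → a ≈ʷ b → Represents a v → Represents b v
≈ʷ-represents a≈b rep i = trans (sym (act a≈b _)) (rep i)

reduced-factor : ∀ {n} {v : Permutation′ n} p {q q′} s → ReducedWord (p ++ q ++ s) v → q ≈ʷ q′ → length q ≤ length q′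
reduced-factor {v = v} p {q} {q′} s (_ , rep , len-pqs) q≈q′ =
  +-cancelʳ-≤ (length s) (length q) (length q′) (+-cancelˡ-≤ (length p) _ _ (begin
    length p + (length q + length s)     ≡⟨ length-++₃ p q s ⟨
    length (p ++ q ++ s)                 ≡⟨ len-pqs ⟩
    len v                                ≤⟨ len≤length v (p ++ q′ ++ s) (≈ʷ-represents {v = v} pqs≈pq′s rep) ⟩
    length (p ++ q′ ++ s)                ≡⟨ length-++₃ p q′ s ⟩
    length p + (length q′ + length s)    ∎))
  where
  open ≤-Reasoning
  pqs≈pq′s : p ++ q ++ s ≈ʷ p ++ q′ ++ s
  pqs≈pq′s = ≈ʷ-++ˡ p (≈ʷ-++ʳ s q≈q′)

All≥⇒cutoff : ∀ {i X} → All (i ≤_) X → CutoffOK i X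
All≥⇒cutoff []         = _
All≥⇒cutoff (i≤x ∷ _) = i≤x

cutoff⇒All : ∀ {i X} → Increasing X → CutoffOK i X → All (i ≤_) X
cutoff⇒All {X = []}    _   _   = []
cutoff⇒All {X = _ ∷ _} inc i≤x = increasing-≥ inc i≤x

validBlock⇒increasing : ∀ {i X} → ValidBlock i X → Increasing X
validBlock⇒increasing (linked , _) = Linked⇒AllPairs <-trans linked

validBlock⇒≥ : ∀ {i X} → ValidBlock i X → All (i ≤_) X
validBlock⇒≥ valid@(_ , cut) = cutoff⇒All (validBlock⇒increasing valid) cut

module _ {n} {v : Permutation′ n} (pre : Fact) {A B : List ℕ} (post : Fact) (rfc : RFC v (pre ++ A ∷ B ∷ post)) where

  private
    i = suc (length pre)
    r = pre ++ A ∷ B ∷ post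

    reduced : ReducedWord (word post ++ (B ++ A) ++ word pre) v
    reduced = subst (λ a → ReducedWord a v) (word-split pre A B post) (proj₁ (proj₂ rfc))

    valid : ∀ j → 1 ≤ j → j ≤ n ∸ 1 → ValidBlock j (blk r j)
    valid = proj₂ (proj₂ rfc)

    1+i≤n-1 : suc i ≤ n ∸ 1
    1+i≤n-1 = begin
      suc (suc (length pre))                 ≤⟨ s≤s (s≤s (m≤m+n (length pre) (length post))) ⟩
      suc (suc (length pre + length post))   ≡⟨ cong suc (+-suc (length pre) (length post)) ⟨
      suc (length pre + suc (length post))   ≡⟨ +-suc (length pre) (suc (length post)) ⟨
      length pre + length (A ∷ B ∷ post)     ≡⟨ length-++ pre ⟨
      length r                               ≡⟨ proj₁ rfc ⟩
      n ∸ 1                                  ∎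
      where open ≤-Reasoning

  RFC-valid-blocks : ValidBlock i A × ValidBlock (suc i) B
  RFC-valid-blocks =
    subst (ValidBlock i) (blk-at pre (B ∷ post)) (valid i (s≤s z≤n) (≤-trans (n≤1+n i) 1+i≤n-1)) ,
    subst (ValidBlock (suc i)) (blk-at-suc pre post) (valid (suc i) (s≤s z≤n) 1+i≤n-1)

  RFC-letters : All (Letter n) (B ++ A)
  RFC-letters = All.++⁻ˡ (B ++ A) (All.++⁻ʳ (word post) (proj₁ reduced))

  RFC-no-shortening : ∀ {W} → B ++ A ≈ʷ W → length (B ++ A) ≤ length W
  RFC-no-shortening = reduced-factor {v = v} (word post) {B ++ A} (word pre) reduced

  RFC-replace : ∀ {A′ B′} → B ++ A ≈ʷ B′ ++ A′ → length (B′ ++ A′) ≡ length (B ++ A) → All (Letter n) (B′ ++ A′) →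
    ValidBlock i A′ → ValidBlock (suc i) B′ → RFC v (pre ++ A′ ∷ B′ ∷ post)
  RFC-replace {A′} {B′} BA≈ length≡ letters′ validA′ validB′ =
    length-r′ , (letters-r′ , ≈ʷ-represents {v = v} r≈r′ (proj₁ (proj₂ reduced)) , length-word-r′) , valid′
    where
    r′ = pre ++ A′ ∷ B′ ∷ post
    length-r′ : length r′ ≡ n ∸ 1
    length-r′ = trans (length-++ pre) (trans (sym (length-++ pre)) (proj₁ rfc))
    letters-r′ : All (Letter n) (word r′)
    letters-r′ = subst (All (Letter n)) (sym (word-split pre A′ B′ post))
      (All.++⁺ (All.++⁻ˡ (word post) (proj₁ reduced))
               (All.++⁺ letters′ (All.++⁻ʳ (B ++ A) (All.++⁻ʳ (word post) (proj₁ reduced)))))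
    r≈r′ : word post ++ (B ++ A) ++ word pre ≈ʷ word r′
    r≈r′ = begin
      word post ++ (B ++ A) ++ word pre     ≈⟨ ≈ʷ-++ˡ (word post) (≈ʷ-++ʳ (word pre) BA≈) ⟩
      word post ++ (B′ ++ A′) ++ word pre   ≡⟨ word-split pre A′ B′ post ⟨
      word r′                               ∎
      where open ≈ʷ-Reasoning
    length-word-r′ : length (word r′) ≡ len v
    length-word-r′ = begin
      length (word r′)                                            ≡⟨ cong length (word-split pre A′ B′ post) ⟩
      length (word post ++ (B′ ++ A′) ++ word pre)                ≡⟨ length-++₃ (word post) (B′ ++ A′) (word pre) ⟩
      length (word post) + (length (B′ ++ A′) + length (word pre)) ≡⟨ cong (λ m → length (word post) + (m + length (word pre))) length≡ ⟩
      length (word post) + (length (B ++ A) + length (word pre))  ≡⟨ length-++₃ (word post) (B ++ A) (word pre) ⟨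
      length (word post ++ (B ++ A) ++ word pre)                  ≡⟨ proj₂ (proj₂ reduced) ⟩
      len v                                                       ∎
      where open ≡-Reasoning
    valid′ : ∀ j → 1 ≤ j → j ≤ n ∸ 1 → ValidBlock j (blk r′ j)
    valid′ j 1≤j j≤n-1 with j ≟ i | j ≟ suc i
    ... | yes refl | _        = subst (ValidBlock i) (sym (blk-at pre (B′ ∷ post))) validA′
    ... | no _     | yes refl = subst (ValidBlock (suc i)) (sym (blk-at-suc pre post)) validB′
    ... | no j≢i   | no j≢1+i = subst (ValidBlock j) (sym (blk-elsewhere pre post j j≢i j≢1+i)) (valid j 1≤j j≤n-1)

-- The raising operator

lastOr-∈ : ∀ u us → lastOr u us ∈ u ∷ us
lastOr-∈ u []        = here refl
lastOr-∈ u (u′ ∷ us) = there (lastOr-∈ u′ us)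

lastOr-max : ∀ {u us} → Increasing (u ∷ us) → All (_≤ lastOr u us) (u ∷ us)
lastOr-max {u} {[]}      _                  = ≤-refl ∷ []
lastOr-max {u} {u′ ∷ us} ((u<u′ ∷ _) ∷ inc) with lastOr-max inc
... | u′≤ ∷ us≤ = ≤-trans (<⇒≤ u<u′) u′≤ ∷ u′≤ ∷ us≤

-- c is the letter v of the raising operator e_i and c + k is its letter s.
record RaiseShape (A B : List ℕ) (c k : ℕ) : Set where
  field
    B₁ B₂ A₁ A₂ : List ℕ
    B-split     : B ≡ B₁ ++ consecutive c (suc k) ++ B₂
    A-split     : A ≡ A₁ ++ consecutive c k ++ A₂
    B₁-low      : All (_< c) B₁
    B₂-high     : All (λ b → suc (c + k) < b) B₂
    A₁-low      : All (λ a → suc a < c) A₁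
    A₂-high     : All (c + k ≤_) A₂

raiseShape : ∀ {A B c} k → Increasing A → Increasing B →
  c ∈ unpairedFrom (reverse A) B → All (_≤ c) (unpairedFrom (reverse A) B) →
  (∀ j → j < k → suc c + j ∈ B) → suc (c + k) ∉ B → RaiseShape A B c k
raiseShape {A} {B} {c} k incA incB c∈U U≤c run stop
  with consecutive-split c (suc k) incB c+j∈B | consecutive-split c k incA c+j∈A
  where
  c+j∈B : ∀ j → j < suc k → c + j ∈ B
  c+j∈B zero    _         = subst (_∈ B) (sym (+-identityʳ c)) (unpairedFrom-⊆ (reverse A) B c∈U)
  c+j∈B (suc j) (s≤s j<k) = subst (_∈ B) (sym (+-suc c j)) (run j j<k)
  c+j∈A : ∀ j → j < k → c + j ∈ A
  c+j∈A j j<k = maxUnpaired-∈ j incA incB c∈U U≤c (λ j′ j′≤j → run j′ (≤-trans j′≤j j<k))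
... | B₁ , B₂ , refl , B₁<c , B₂≥ | A₁ , A₂ , refl , A₁<c , A₂≥ = record
  { B-split = refl
  ; A-split = refl
  ; B₁-low  = B₁<c
  ; B₂-high = All.zipWith (λ (≥ , ≢) → ≤∧≢⇒< (≤-trans (≤-reflexive (sym (+-suc c k))) ≥) ≢)
                (B₂≥ , All.++⁻ʳ (consecutive c (suc k)) (All.++⁻ʳ B₁ (All.¬Any⇒All¬ {P = suc (c + k) ≡_} _ stop)))
  ; A₁-low  = All.tabulate λ {a} a∈A₁ → ≤∧≢⇒< (All.lookup A₁<c a∈A₁)
                λ 1+a≡c → unpaired-suc⇒∉ incB (subst (_∈ unpairedFrom (reverse A) B) (sym 1+a≡c) c∈U) (∈-++⁺ˡ a∈A₁)
  ; A₂-high = A₂≥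
  }

remove-first : ∀ {c} B₁ rest → All (_< c) B₁ → remove c (B₁ ++ c ∷ rest) ≡ B₁ ++ rest
remove-first {c} []       rest []          rewrite ≡ᵇ-true {c} refl = refl
remove-first {c} (b ∷ B₁) rest (b<c ∷ B₁<c) rewrite ≡ᵇ-false (>⇒≢ b<c) = cong (b ∷_) (remove-first B₁ rest B₁<c)

insertSorted-between : ∀ {s} xs ys → All (_< s) xs → All (s ≤_) ys → insertSorted s (xs ++ ys) ≡ xs ++ s ∷ ys
insertSorted-between []       []       []            _         = refl
insertSorted-between []       (y ∷ ys) []            (s≤y ∷ _) rewrite <ᵇ-false (≤⇒≯ s≤y) = refl
insertSorted-between (x ∷ xs) ys       (x<s ∷ xs<s) s≤ys      rewrite <ᵇ-true x<s =
  cong (x ∷_) (insertSorted-between xs ys xs<s s≤ys)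

module Raise {A B c k} (shape : RaiseShape A B c k) where

  open RaiseShape shape public

  private
    R  = consecutive c (suc k)
    R′ = consecutive (suc c) k
    Q  = consecutive c k
    s  = c + k
    A₁<c : All (_< c) A₁
    A₁<c = All.map (<-trans (n<1+n _)) A₁-low

  A′ B′ : List ℕ
  A′ = A₁ ++ R ++ A₂
  B′ = B₁ ++ R′ ++ B₂

  BA-split : B ++ A ≡ B₁ ++ R ++ B₂ ++ A₁ ++ Q ++ A₂
  BA-split = trans (cong₂ _++_ B-split A-split) (++-assoc₃ B₁ R B₂ _)

  raised-≈ʷ : B ++ A ≈ʷ B′ ++ A′
  raised-≈ʷ = subst₂ (λ X Y → X ++ Y ≈ʷ B′ ++ A′) (sym B-split) (sym A-split) (raise-≈ʷ c k B₁ B₂ A₁ A₂ B₂-high A₁-low)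

  raised-length : length (B′ ++ A′) ≡ length (B ++ A)
  raised-length = begin
    length (B′ ++ A′)                          ≡⟨ cong length (++-assoc₃ B₁ R′ B₂ A′) ⟩
    length (B₁ ++ R′ ++ B₂ ++ A₁ ++ R ++ A₂)   ≡⟨ length-++₆ B₁ R′ B₂ A₁ R A₂ ⟩
    sum (length R′) (length R)                 ≡⟨ cong₂ sum (length-consecutive (suc c) k) (length-consecutive c (suc k)) ⟩
    sum k (suc k)                              ≡⟨ arithmetic (length B₁) k (length B₂) (length A₁) (length A₂) ⟩
    sum (suc k) k                              ≡⟨ cong₂ sum (length-consecutive c (suc k)) (length-consecutive c k) ⟨
    sum (length R) (length Q)                  ≡⟨ length-++₆ B₁ R B₂ A₁ Q A₂ ⟨
    length (B₁ ++ R ++ B₂ ++ A₁ ++ Q ++ A₂)    ≡⟨ cong length BA-split ⟨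
    length (B ++ A)                            ∎
    where
    open ≡-Reasoning
    sum : ℕ → ℕ → ℕ
    sum x y = length B₁ + (x + (length B₂ + (length A₁ + (y + length A₂))))
    arithmetic : ∀ b₁ k b₂ a₁ a₂ → b₁ + (k + (b₂ + (a₁ + (suc k + a₂)))) ≡ b₁ + (suc k + (b₂ + (a₁ + (k + a₂))))
    arithmetic = solve-∀

  private
    B-parts : ∀ {Φ : ℕ → Set} → All Φ B → All Φ B₁ × All Φ R × All Φ B₂
    B-parts {Φ} ΦB = let ΦB′ = subst (All Φ) B-split ΦB in
      All.++⁻ˡ B₁ ΦB′ , All.++⁻ˡ R (All.++⁻ʳ B₁ ΦB′) , All.++⁻ʳ R (All.++⁻ʳ B₁ ΦB′)
    A-parts : ∀ {Φ : ℕ → Set} → All Φ A → All Φ A₁ × All Φ Q × All Φ A₂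
    A-parts {Φ} ΦA = let ΦA′ = subst (All Φ) A-split ΦA in
      All.++⁻ˡ A₁ ΦA′ , All.++⁻ˡ Q (All.++⁻ʳ A₁ ΦA′) , All.++⁻ʳ Q (All.++⁻ʳ A₁ ΦA′)

  raisedA-all : ∀ {Φ : ℕ → Set} → All Φ A → All Φ B → All Φ A′
  raisedA-all ΦA ΦB with A-parts ΦA | B-parts ΦB
  ... | ΦA₁ , _ , ΦA₂ | _ , ΦR , _ = All.++⁺ ΦA₁ (All.++⁺ ΦR ΦA₂)

  raisedB-all : ∀ {Φ : ℕ → Set} → All Φ B → All Φ B′
  raisedB-all ΦB with B-parts ΦB
  ... | ΦB₁ , _ ∷ ΦR′ , ΦB₂ = All.++⁺ ΦB₁ (All.++⁺ ΦR′ ΦB₂)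

  remove-raised : remove c B ≡ B′
  remove-raised = trans (cong (remove c) B-split) (remove-first B₁ (R′ ++ B₂) B₁-low)

  insertSorted-raised : All (s <_) A₂ → insertSorted s A ≡ A′
  insertSorted-raised s<A₂ = begin
    insertSorted s A                     ≡⟨ cong (insertSorted s) (trans A-split (sym (++-assoc A₁ Q A₂))) ⟩
    insertSorted s ((A₁ ++ Q) ++ A₂)     ≡⟨ insertSorted-between (A₁ ++ Q) A₂ (All.++⁺ A₁<s (consecutive-< c k)) (All.map <⇒≤ s<A₂) ⟩
    (A₁ ++ Q) ++ s ∷ A₂                  ≡⟨ ++-assoc A₁ Q (s ∷ A₂) ⟩
    A₁ ++ Q ++ s ∷ A₂                    ≡⟨ cong (A₁ ++_) (++-assoc Q (s ∷ []) A₂) ⟨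
    A₁ ++ (Q ∷ʳ s) ++ A₂                 ≡⟨ cong (λ X → A₁ ++ X ++ A₂) (consecutive-∷ʳ c k) ⟨
    A′                                   ∎
    where
    open ≡-Reasoning
    A₁<s = All.map (λ a<c → <-≤-trans a<c (m≤m+n c k)) A₁<c

  A₂-increasing : Increasing A → Increasing A₂
  A₂-increasing incA = AllPairs-++⁻ʳ Q (AllPairs-++⁻ʳ A₁ (subst Increasing A-split incA))

  raisedA-increasing : Increasing A → All (s <_) A₂ → Increasing A′
  raisedA-increasing incA s<A₂ =
    AllPairs.++⁺ incA₁ (AllPairs.++⁺ (consecutive-increasing c (suc k)) incA₂ R<A₂) A₁<RA₂
    where
    incA₁ = AllPairs-++⁻ˡ A₁ (subst Increasing A-split incA)
    incA₂ = A₂-increasing incA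
    R<A₂ : All (λ x → All (x <_) A₂) R
    R<A₂ = All.map (λ {x} x<c+1+k → All.map (≤-<-trans (s≤s⁻¹ (subst (x <_) (+-suc c k) x<c+1+k))) s<A₂)
                   (consecutive-< c (suc k))
    c≤RA₂ : All (c ≤_) (R ++ A₂)
    c≤RA₂ = All.++⁺ (consecutive-≥ c (suc k)) (All.map (λ s<y → ≤-trans (m≤m+n c k) (<⇒≤ s<y)) s<A₂)
    A₁<RA₂ : All (λ a → All (a <_) (R ++ A₂)) A₁
    A₁<RA₂ = All.map (λ a<c → All.map (<-≤-trans a<c) c≤RA₂) A₁<c

  raisedB-increasing : Increasing B → Increasing B′
  raisedB-increasing incB = AllPairs-delete B₁ (subst Increasing B-split incB)

  shortening : ∀ {A₃} → A₂ ≡ s ∷ A₃ → ∃ λ W → B ++ A ≈ʷ W × length W < length (B ++ A)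
  shortening {A₃} refl = W , BA≈W , ≤-trans (n≤1+n _) (≤-reflexive length-W)
    where
    W = B₁ ++ A₁ ++ R′ ++ Q ++ B₂ ++ A₃
    A≡ : A ≡ A₁ ++ R ++ A₃
    A≡ = trans A-split (cong (A₁ ++_) (trans (sym (++-assoc Q (s ∷ []) A₃)) (cong (_++ A₃) (sym (consecutive-∷ʳ c k)))))
    BA≈W : B ++ A ≈ʷ W
    BA≈W = subst₂ (λ X Y → X ++ Y ≈ʷ W) (sym B-split) (sym A≡) (shorten-≈ʷ c k B₁ B₂ A₁ A₃ B₂-high A₁-low)
    length-W : suc (suc (length W)) ≡ length (B ++ A)
    length-W = begin
      suc (suc (length W))                       ≡⟨ cong (suc ∘ suc) (length-++₆ B₁ A₁ R′ Q B₂ A₃) ⟩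
      suc (suc (sum′ (length R′) (length Q)))    ≡⟨ cong₂ (λ x y → suc (suc (sum′ x y))) (length-consecutive (suc c) k) (length-consecutive c k) ⟩
      suc (suc (sum′ k k))                       ≡⟨ arithmetic (length B₁) k (length B₂) (length A₁) (length A₃) ⟩
      sum (suc k)                                ≡⟨ cong sum (length-consecutive c (suc k)) ⟨
      sum (length R)                             ≡⟨ length-++₆ B₁ R B₂ A₁ R A₃ ⟨
      length (B₁ ++ R ++ B₂ ++ A₁ ++ R ++ A₃)    ≡⟨ cong length (++-assoc₃ B₁ R B₂ _) ⟨
      length ((B₁ ++ R ++ B₂) ++ A₁ ++ R ++ A₃)  ≡⟨ cong₂ (λ X Y → length (X ++ Y)) B-split A≡ ⟨
      length (B ++ A)                            ∎
      where
      open ≡-Reasoning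
      sum′ : ℕ → ℕ → ℕ
      sum′ x y = length B₁ + (length A₁ + (x + (y + (length B₂ + length A₃))))
      sum : ℕ → ℕ
      sum x = length B₁ + (x + (length B₂ + (length A₁ + (x + length A₃))))
      arithmetic : ∀ b₁ k b₂ a₁ a₃ → suc (suc (b₁ + (a₁ + (k + (k + (b₂ + a₃)))))) ≡ b₁ + (suc k + (b₂ + (a₁ + (suc k + a₃))))
      arithmetic = solve-∀

raiseCand-unpaired : ∀ i r {u us} → unpaired i r ≡ u ∷ us →
  raiseCand i r ≡ just (setBlk i (insertSorted (findS (suc (length (blk r (suc i)))) (blk r (suc i)) (lastOr u us)) (blk r i))
                              (setBlk (suc i) (remove (lastOr u us) (blk r (suc i))) r))
raiseCand-unpaired i r eq with unpaired i r | eq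
... | _ | refl = refl

raiseCand-split : ∀ (pre : Fact) {A B} post {u us} → unpairedFrom (reverse A) B ≡ u ∷ us →
  raiseCand (suc (length pre)) (pre ++ A ∷ B ∷ post)
    ≡ just (pre ++ insertSorted (findS (suc (length B)) B (lastOr u us)) A ∷ remove (lastOr u us) B ∷ post)
raiseCand-split pre {A} {B} post {u} {us} U≡ = begin
  raiseCand i r
    ≡⟨ raiseCand-unpaired i r (trans (cong₂ (λ X Y → unpairedFrom (reverse X) Y) blk-i blk-1+i) U≡) ⟩
  just (setBlk i (insertSorted (S (blk r (suc i))) (blk r i)) (setBlk (suc i) (remove c (blk r (suc i))) r))
    ≡⟨ cong₂ (λ X Y → just (setBlk i (insertSorted (S Y) X) (setBlk (suc i) (remove c Y) r))) blk-i blk-1+i ⟩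
  just (setBlk i (insertSorted (S B) A) (setBlk (suc i) (remove c B) r))
    ≡⟨ cong (just ∘ setBlk i (insertSorted (S B) A)) (setBlk-at-suc pre (remove c B) post) ⟩
  just (setBlk i (insertSorted (S B) A) (pre ++ A ∷ remove c B ∷ post))
    ≡⟨ cong just (setBlk-at pre (insertSorted (S B) A) (remove c B ∷ post)) ⟩
  just (pre ++ insertSorted (S B) A ∷ remove c B ∷ post)
    ∎
  where
  open ≡-Reasoning
  i = suc (length pre)
  r = pre ++ A ∷ B ∷ post
  c = lastOr u us
  S : List ℕ → ℕ
  S X = findS (suc (length X)) X c
  blk-i : blk r i ≡ A
  blk-i = blk-at pre (B ∷ post)
  blk-1+i : blk r (suc i) ≡ B
  blk-1+i = blk-at-suc pre post

module _ {n} {v : Permutation′ n} (pre : Fact) {A B : List ℕ} (post : Fact) (rfc : RFC v (pre ++ A ∷ B ∷ post)) where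

  private
    i = suc (length pre)
    validA : ValidBlock i A
    validA = proj₁ (RFC-valid-blocks {v = v} pre {A} {B} post rfc)
    validB : ValidBlock (suc i) B
    validB = proj₂ (RFC-valid-blocks {v = v} pre {A} {B} post rfc)
    incA : Increasing A
    incA = validBlock⇒increasing validA
    incB : Increasing B
    incB = validBlock⇒increasing validB

  raiseShape-above : ∀ {c k} (shape : RaiseShape A B c k) → All (c + k <_) (RaiseShape.A₂ shape)
  raiseShape-above shape with head-or-above (Raise.A₂-increasing shape incA) (RaiseShape.A₂-high shape)
  ... | inj₂ above       = above
  ... | inj₁ (_ , A₂≡) with Raise.shortening shape A₂≡
  ...   | W , BA≈W , shorter = contradiction (RFC-no-shortening {v = v} pre {A} {B} post rfc BA≈W) (<⇒≱ shorter)

  raiseShape-RFC : ∀ {c k} (shape : RaiseShape A B c k) → let open Raise shape in RFC v (pre ++ A′ ∷ B′ ∷ post)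
  raiseShape-RFC shape = RFC-replace {v = v} pre {A} {B} post rfc raised-≈ʷ raised-length letters′ validA′ validB′
    where
    open Raise shape
    letters : All (Letter n) (B ++ A)
    letters = RFC-letters {v = v} pre {A} {B} post rfc
    letters′ : All (Letter n) (B′ ++ A′)
    letters′ = All.++⁺ (raisedB-all (All.++⁻ˡ B letters)) (raisedA-all (All.++⁻ʳ B letters) (All.++⁻ˡ B letters))
    validA′ : ValidBlock i A′
    validA′ = AllPairs⇒Linked (raisedA-increasing incA (raiseShape-above shape)) ,
              All≥⇒cutoff (raisedA-all (validBlock⇒≥ validA) (All.map (≤-trans (n≤1+n i)) (validBlock⇒≥ validB)))
    validB′ : ValidBlock (suc i) B′
    validB′ = AllPairs⇒Linked (raisedB-increasing incB) , All≥⇒cutoff (raisedB-all (validBlock⇒≥ validB))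

  unpaired⇒¬raiseZero : ∀ {u us} → unpairedFrom (reverse A) B ≡ u ∷ us → ¬ RaiseZero v i (pre ++ A ∷ B ∷ post)
  unpaired⇒¬raiseZero {u} {us} U≡ raise-zero with findS-consecutive (lastOr u us) incB
  ... | k , findS≡ , run , stop = raise-zero _ candidate≡ (raiseShape-RFC shape)
    where
    c = lastOr u us
    c∈U : c ∈ unpairedFrom (reverse A) B
    c∈U = subst (c ∈_) (sym U≡) (lastOr-∈ u us)
    U≤c : All (_≤ c) (unpairedFrom (reverse A) B)
    U≤c = subst (All (_≤ c)) (sym U≡) (lastOr-max (subst Increasing U≡ (unpairedFrom-increasing (reverse A) incB)))
    shape = raiseShape k incA incB c∈U U≤c run stop
    open Raise shape
    candidate≡ : raiseCand i (pre ++ A ∷ B ∷ post) ≡ just (pre ++ A′ ∷ B′ ∷ post)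
    candidate≡ = trans (raiseCand-split pre {A} {B} post U≡)
      (cong₂ (λ X Y → just (pre ++ X ∷ Y ∷ post))
             (trans (cong (λ t → insertSorted t A) findS≡) (insertSorted-raised (raiseShape-above shape)))
             remove-raised)

  raiseZero⇒columnStrict : RaiseZero v i (pre ++ A ∷ B ∷ post) → ColumnStrict A B
  raiseZero⇒columnStrict raise-zero with unpairedFrom (reverse A) B in U≡
  ... | []     = allPaired⇒columnStrict incA incB U≡
  ... | u ∷ us = contradiction raise-zero (unpaired⇒¬raiseZero U≡)

All-blk : ∀ {Φ : List ℕ → Set} r → (∀ j → 1 ≤ j → j ≤ length r → Φ (blk r j)) → All Φ r
All-blk []      _ = []
All-blk (R ∷ T) h = h 1 ≤-refl (s≤s z≤n) ∷ All-blk T λ { (suc j) _ j≤ → h (suc (suc j)) (s≤s z≤n) (s≤s j≤) }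

Linked-blk : ∀ {_∼_ : List ℕ → List ℕ → Set} r → (∀ j → 1 ≤ j → suc j ≤ length r → blk r j ∼ blk r (suc j)) → Linked _∼_ r
Linked-blk []          _ = []
Linked-blk (R ∷ [])    _ = [-]
Linked-blk (R ∷ S ∷ T) h = h 1 ≤-refl (s≤s (s≤s z≤n)) ∷ Linked-blk (S ∷ T) λ { (suc j) _ j≤ → h (suc (suc j)) (s≤s z≤n) (s≤s j≤) }

RFC⇒increasing : ∀ {n} {v : Permutation′ n} {r} → RFC v r → All Increasing r
RFC⇒increasing {r = r} (length≡ , _ , blocks) =
  All-blk r λ j 1≤j j≤ → validBlock⇒increasing (blocks j 1≤j (subst (j ≤_) length≡ j≤))

highestWeight⇒columnStrict : ∀ {n} {v : Permutation′ n} {r} → RFC v r → HighestWeight v r → Linked ColumnStrict r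
highestWeight⇒columnStrict {n} {v} {r} rfc hw = Linked-blk r adjacent
  where
  adjacent : ∀ j → 1 ≤ j → suc j ≤ length r → ColumnStrict (blk r j) (blk r (suc j))
  adjacent (suc j₀) _ 2+j₀≤ with split-at j₀ r 2+j₀≤
  ... | pre , A , B , post , refl , refl =
    subst₂ ColumnStrict (sym (blk-at pre (B ∷ post))) (sym (blk-at-suc pre post))
      (raiseZero⇒columnStrict {v = v} pre {A} {B} post rfc (hw (suc (length pre)) (s≤s z≤n) (≤-trans (subst (_ ≤_) (proj₁ rfc) 2+j₀≤) (m∸n≤m n 1))))

proposition6p13 : (n : ℕ) (w : Permutation′ n) (r : Fact) →
    RFC (flip w) r → HighestWeight (flip w) r →
    (i : ℕ) → 1 ≤ i → row (P (word r)) i ≡ blk r i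
proposition6p13 n w r rfc hw i _ =
  P-word-rows (RFC⇒increasing {v = flip w} rfc) (highestWeight⇒columnStrict {v = flip w} rfc hw) i
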